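{- Let $x$ be a finite set, let $\pi=\{b_1,\dots,b_k\}$ be a partition of $x$, and let $S_\pi\subseteq S_x$ be the Young subgroup of permutations of $x$ mapping each block $b_i$ to itself. Then (1) $\langle P(x)\rangle/S_\pi\cong\bigotimes_{i=1}^{k}\big(\langle P[1]\rangle^{\otimes|b_i|}/S_{|b_i|}\big)=\bigotimes_{i=1}^{k}\mathrm{Sym}^{|b_i|}\langle P[1]\rangle$, via a linear isomorphism intertwining the induced union, intersection and complement operations; and (2) $\dim(\langle P(x)\rangle/S_\pi)=\prod_{i=1}^{k}(|b_i|+1)$.
   Context: $\mathbb{K}$ is a field of characteristic zero, $P[1]=P(\{1\})$. For a set $x$, $\langle P(x)\rangle$ is the $\mathbb{K}$-vector space with basis the subsets of $x$, with union and intersection the bilinear extensions of the set operations and complement the linear extension of $a\mapsto x\setminus a$; a subgroup $G\subseteq S_x$ acts by $\sigma\cdot a=\sigma(a)$. If a finite group $G$ acts by automorphisms on a $\mathbb{K}$-algebra $A$, the coinvariant space $A/G=A/\langle ga-a\rangle$ carries the product $\bar a\,\bar b=\frac{1}{|G|}\sum_{g\in G}\overline{a\,(gb)}$ (applied to union and to intersection); complement descends. $\langle P[1]\rangle^{\otimes n}$ has componentwise operations and $S_n$ permutes tensor factors; $\mathrm{Sym}^n\langle P[1]\rangle=\langle P[1]\rangle^{\otimes n}/S_n$. Tensor products of such algebras carry componentwise operations. -}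

module Defs where

open import Level using (Level; _⊔_; Lift) renaming (suc to lsuc)
open import Algebra.Bundles using (CommutativeRing)
open import Data.Nat as ℕ using (ℕ; zero; suc)
open import Data.Fin as Fin using (Fin; zero; suc)
open import Data.Fin.Properties using () renaming (_≟_ to _≟F_)
open import Data.Fin.Subset as Sub using (Subset)
open import Data.Bool using (Bool; true; false; _∧_; _∨_; not; if_then_else_)
open import Data.Vec as Vec using (Vec; []; _∷_)
open import Data.Vec.Properties using (≡-dec)
open import Data.Bool.Properties using () renaming (_≟_ to _≟B_)
open import Data.List as List using (List; []; _∷_; _++_; map; foldr; concatMap; length; allFin; filterᵇ; lookup)
open import Data.Bool.ListAction using (and)
open import Data.Nat.ListAction using (product)
open import Data.Product using (Σ; ∃; _×_; _,_; proj₁; proj₂)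
open import Relation.Nullary using (¬_; Dec; yes; no)
open import Relation.Nullary.Decidable using (⌊_⌋)
open import Relation.Binary.PropositionalEquality using (_≡_; refl)
open import Relation.Binary.Definitions using (DecidableEquality)

record Field (c ℓ : Level) : Set (lsuc (c ⊔ ℓ)) where
  field
    commutativeRing : CommutativeRing c ℓ
  open CommutativeRing commutativeRing public
  field
    _⁻¹     : Carrier → Carrier
    0≉1     : ¬ (0# ≈ 1#)
    ⁻¹-inverseʳ : ∀ x → ¬ (x ≈ 0#) → (x * (x ⁻¹)) ≈ 1#

module FieldOps {c ℓ} (K : Field c ℓ) where
  open Field K

  ι : ℕ → Carrier
  ι zero    = 0#
  ι (suc n) = 1# + ι n

  Σ-list : ∀ {a} {A : Set a} → List A → (A → Carrier) → Carrier
  Σ-list xs f = foldr (λ a s → f a + s) 0# xs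

  Σ-fin : (d : ℕ) → (Fin d → Carrier) → Carrier
  Σ-fin d f = Σ-list (allFin d) f

CharZero : ∀ {c ℓ} → Field c ℓ → Set ℓ
CharZero K = ∀ n → ¬ (ι (suc n) ≈ 0#)
  where open Field K ; open FieldOps K

-- Vector spaces over K carrying union, intersection and complement
-- operations (given concretely; laws are not part of the structure,
-- all instances below are concrete constructions).

record SetAlg {c ℓ} (K : Field c ℓ) : Set (lsuc (c ⊔ ℓ)) where
  module K = Field K
  field
    Carrier : Set c
    _≈_     : Carrier → Carrier → Set (c ⊔ ℓ)
    _+_     : Carrier → Carrier → Carrier
    0v      : Carrier
    _·_     : K.Carrier → Carrier → Carrier
    _∪_     : Carrier → Carrier → Carrier
    _∩_     : Carrier → Carrier → Carrier
    ∁       : Carrier → Carrier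

  -_ : Carrier → Carrier
  - v = (K.- K.1#) · v

  _-_ : Carrier → Carrier → Carrier
  u - v = u + (- v)

  ΣV : ∀ {a} {A : Set a} → List A → (A → Carrier) → Carrier
  ΣV xs f = foldr (λ a s → f a + s) 0v xs

  lincomb : (d : ℕ) → (Fin d → K.Carrier) → (Fin d → Carrier) → Carrier
  lincomb d c e = ΣV (allFin d) (λ j → c j · e j)

module _ {c ℓ} {K : Field c ℓ} where
  open SetAlg

  IsBasis : (A : SetAlg K) (d : ℕ) → (Fin d → Carrier A) → Set (c ⊔ ℓ)
  IsBasis A d e =
      (∀ (a : Fin d → Field.Carrier K) → _≈_ A (lincomb A d a e) (0v A)
          → ∀ j → Field._≈_ K (a j) (Field.0# K))
    × (∀ (v : Carrier A) → ∃ λ (a : Fin d → Field.Carrier K) → _≈_ A v (lincomb A d a e))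

  HasDim : SetAlg K → ℕ → Set (c ⊔ ℓ)
  HasDim A d = ∃ λ (e : Fin d → Carrier A) → IsBasis A d e

  record AlgIso (A B : SetAlg K) : Set (c ⊔ ℓ) where
    field
      φ       : Carrier A → Carrier B
      φ-cong  : ∀ {u v} → _≈_ A u v → _≈_ B (φ u) (φ v)
      φ-+     : ∀ u v → _≈_ B (φ (_+_ A u v)) (_+_ B (φ u) (φ v))
      φ-·     : ∀ a v → _≈_ B (φ (_·_ A a v)) (_·_ B a (φ v))
      φ-inj   : ∀ {u v} → _≈_ B (φ u) (φ v) → _≈_ A u v
      φ-surj  : ∀ w → ∃ λ v → _≈_ B (φ v) w
      φ-∪     : ∀ u v → _≈_ B (φ (_∪_ A u v)) (_∪_ B (φ u) (φ v))
      φ-∩     : ∀ u v → _≈_ B (φ (_∩_ A u v)) (_∩_ B (φ u) (φ v))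
      φ-∁     : ∀ v → _≈_ B (φ (∁ A v)) (∁ B (φ v))

-- Free vector space ⟨B⟩ on a finite set B of "sets" with operations;
-- operations extended bilinearly (resp. linearly for complement).

record FinSetOps : Set₁ where
  field
    Elt  : Set
    enum : List Elt          -- every element exactly once
    _≟_  : DecidableEquality Elt
    _∪ₑ_ : Elt → Elt → Elt
    _∩ₑ_ : Elt → Elt → Elt
    ∁ₑ   : Elt → Elt

module _ {c ℓ} (K : Field c ℓ) where
  open Field K
  open FieldOps K

  Lin : FinSetOps → SetAlg K
  Lin B = record
    { Carrier = Elt → Carrier
    ; _≈_ = λ f g → Lift c (∀ b → f b ≈ g b)
    ; _+_ = λ f g b → f b + g b
    ; 0v  = λ _ → 0#
    ; _·_ = λ a f b → a * f b
    ; _∪_ = bilin _∪ₑ_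
    ; _∩_ = bilin _∩ₑ_
    ; ∁   = λ f b → Σ-list enum (λ a → if ⌊ ∁ₑ a ≟ b ⌋ then f a else 0#)
    }
    where
    open FinSetOps B
    bilin : (Elt → Elt → Elt) → (Elt → Carrier) → (Elt → Carrier) → Elt → Carrier
    bilin op f g b = Σ-list enum λ a → Σ-list enum λ a' →
      if ⌊ op a a' ≟ b ⌋ then f a * g a' else 0#

-- Subsets of Fin n (the finite set x = {0,…,n-1})

allSubsets : (n : ℕ) → List (Subset n)
allSubsets zero    = [] ∷ []
allSubsets (suc n) = concatMap (λ s → (false ∷ s) ∷ (true ∷ s) ∷ []) (allSubsets n)

PowOps : ℕ → FinSetOps
PowOps n = record
  { Elt = Subset n ; enum = allSubsets n ; _≟_ = ≡-dec _≟B_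
  ; _∪ₑ_ = Sub._∪_ ; _∩ₑ_ = Sub._∩_ ; ∁ₑ = Sub.∁ }

⟨P⟩ : ∀ {c ℓ} (K : Field c ℓ) → ℕ → SetAlg K
⟨P⟩ K n = Lin K (PowOps n)

⟨P[1]⟩ : ∀ {c ℓ} (K : Field c ℓ) → SetAlg K
⟨P[1]⟩ K = ⟨P⟩ K 1

-- Tensor product of a finite family of spaces W₀,…,W_{k-1}:
-- formal linear combinations of pure tensors modulo multilinearity.
-- Operations are componentwise on pure tensors, extended bilinearly.

update : ∀ {a} {k : ℕ} {F : Fin k → Set a} → ((i : Fin k) → F i) → (i : Fin k) → F i → (j : Fin k) → F j
update t i u j with j ≟F i
... | yes refl = u
... | no _     = t j

module Tensor {c ℓ} (K : Field c ℓ) {k : ℕ} (W : Fin k → SetAlg K) where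
  open Field K renaming (Carrier to Kc; _≈_ to _≈K_; _+_ to _+K_; _*_ to _*K_)
  open SetAlg

  Tup : Set c
  Tup = (i : Fin k) → Carrier (W i)

  Term : Set c
  Term = List (Kc × Tup)

  data _~_ : Term → Term → Set (c ⊔ ℓ) where
    ~refl   : ∀ {s} → s ~ s
    ~sym    : ∀ {s t} → s ~ t → t ~ s
    ~trans  : ∀ {s t u} → s ~ t → t ~ u → s ~ u
    ~++     : ∀ {s s' t t'} → s ~ s' → t ~ t' → (s ++ t) ~ (s' ++ t')
    ~swap   : ∀ s t → (s ++ t) ~ (t ++ s)
    ~coef   : ∀ {a b} t → a ≈K b → ((a , t) ∷ []) ~ ((b , t) ∷ [])
    ~slot   : ∀ a {t t'} → (∀ i → _≈_ (W i) (t i) (t' i)) → ((a , t) ∷ []) ~ ((a , t') ∷ [])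
    ~zero   : ∀ t → ((0# , t) ∷ []) ~ []
    ~addc   : ∀ a b t → ((a , t) ∷ (b , t) ∷ []) ~ ((a +K b , t) ∷ [])
    ~adds   : ∀ a t i u v → ((a , update t i (_+_ (W i) u v)) ∷ [])
                              ~ ((a , update t i u) ∷ (a , update t i v) ∷ [])
    ~scal   : ∀ a t i b u → ((a , update t i (_·_ (W i) b u)) ∷ [])
                              ~ ((a *K b , update t i u) ∷ [])

  bilinT : (∀ i → Carrier (W i) → Carrier (W i) → Carrier (W i)) → Term → Term → Term
  bilinT op s t = concatMap (λ p → map (λ q → (proj₁ p *K proj₁ q , λ i → op i (proj₂ p i) (proj₂ q i))) t) s

  ⊗ : SetAlg K
  ⊗ = record
    { Carrier = Term
    ; _≈_ = _~_
    ; _+_ = _++_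
    ; 0v = []
    ; _·_ = λ a → map (λ p → (a *K proj₁ p , proj₂ p))
    ; _∪_ = bilinT (λ i → _∪_ (W i))
    ; _∩_ = bilinT (λ i → _∩_ (W i))
    ; ∁   = map (λ p → (proj₁ p , λ i → ∁ (W i) (proj₂ p i)))
    }

-- Coinvariants A/G of a finite group G acting on A by automorphisms.
-- G is given by the list `elems` of its elements (each exactly once)
-- together with the action.  A/G has the same carrier, with
-- u ≈ v iff u - v lies in the span of {g·w - w}; products
-- ū v̄ = (1/|G|) Σ_g u (g v); complement descends.

module _ {c ℓ} {K : Field c ℓ} where
  open FieldOps K
  Coinv : (A : SetAlg K) {G : Set} (elems : List G) → (G → SetAlg.Carrier A → SetAlg.Carrier A) → SetAlg K
  Coinv A {G} elems act = record
    { Carrier = Carrier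
    ; _≈_ = λ u v → ∃ λ (ps : List (Fin (length elems) × Carrier)) →
              (u - v) ≈ ΣV ps (λ p → act (lookup elems (proj₁ p)) (proj₂ p) - proj₂ p)
    ; _+_ = _+_
    ; 0v = 0v
    ; _·_ = _·_
    ; _∪_ = avg _∪_
    ; _∩_ = avg _∩_
    ; ∁ = ∁
    }
    where
    open SetAlg A
    avg : (Carrier → Carrier → Carrier) → Carrier → Carrier → Carrier
    avg op u v = ((ι (length elems)) K.⁻¹) · ΣV elems (λ g → op u (act g v))

allFuns : (n m : ℕ) → List (Fin n → Fin m)
allFuns zero    m = (λ ()) ∷ []
allFuns (suc n) m = concatMap (λ v → map (λ f → λ { zero → v ; (suc i) → f i }) (allFuns n m)) (List.allFin m)

_==_ : ∀ {n} → Fin n → Fin n → Bool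
i == j = ⌊ i ≟F j ⌋

isPermᵇ : ∀ {n} → (Fin n → Fin n) → Bool
isPermᵇ {n} f = and (map (λ i → and (map (λ j → not (f i == f j) ∨ (i == j)) (allFin n))) (allFin n))

Sym : (m : ℕ) → List (Fin m → Fin m)
Sym m = filterᵇ isPermᵇ (allFuns m m)

-- Young subgroup S_π for the partition of Fin n into the blocks
-- b_i = blk⁻¹(i): permutations σ with blk ∘ σ = blk
Young : ∀ {n k} → (Fin n → Fin k) → List (Fin n → Fin n)
Young {n} blk = filterᵇ (λ σ → isPermᵇ σ ∧ and (map (λ j → blk (σ j) == blk j) (allFin n))) (allFuns n n)

-- permutation action on subsets (σ·a = σ⁻¹ image, i.e. preimage a∘σ;
-- since the groups are closed under inverses this gives the same
-- coinvariant space and products) extended linearly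
actP : ∀ {c ℓ} (K : Field c ℓ) {n} → (Fin n → Fin n) → SetAlg.Carrier (⟨P⟩ K n) → SetAlg.Carrier (⟨P⟩ K n)
actP K σ f a = f (Vec.tabulate (λ j → Vec.lookup a (σ j)))

⟨P⟩/Young : ∀ {c ℓ} (K : Field c ℓ) {n k} → (Fin n → Fin k) → SetAlg K
⟨P⟩/Young K {n} blk = Coinv (⟨P⟩ K n) (Young blk) (actP K)

⟨P[1]⟩^⊗ : ∀ {c ℓ} (K : Field c ℓ) → ℕ → SetAlg K
⟨P[1]⟩^⊗ K m = Tensor.⊗ K {m} (λ _ → ⟨P[1]⟩ K)

actT : ∀ {c ℓ} (K : Field c ℓ) {m} → (Fin m → Fin m) → SetAlg.Carrier (⟨P[1]⟩^⊗ K m) → SetAlg.Carrier (⟨P[1]⟩^⊗ K m)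
actT K σ = map (λ p → (proj₁ p , λ i → proj₂ p (σ i)))

Symᵐ⟨P[1]⟩ : ∀ {c ℓ} (K : Field c ℓ) → ℕ → SetAlg K
Symᵐ⟨P[1]⟩ K m = Coinv (⟨P[1]⟩^⊗ K m) (Sym m) (actT K)

blockSize : ∀ {n k} → (Fin n → Fin k) → Fin k → ℕ
blockSize {n} blk i = length (filterᵇ (λ j → blk j == i) (allFin n))

⊗Sym : ∀ {c ℓ} (K : Field c ℓ) {n k} → (Fin n → Fin k) → SetAlg K
⊗Sym K {k = k} blk = Tensor.⊗ K {k} (λ i → Symᵐ⟨P[1]⟩ K (blockSize blk i))

dimFormula : ∀ {n k} → (Fin n → Fin k) → ℕ
dimFormula {k = k} blk = product (map (λ i → suc (blockSize blk i)) (allFin k))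

{-# OPTIONS --safe #-}
module Submission where

-- A subset A of x is the same as the tuple of its traces A ∩ b_i, i.e. the pure tensor
-- ⊗_i (e_{A ∩ b_i}) of basis vectors e_∅, e_{1} of ⟨P[1]⟩ laid out along the blocks; φ sends
-- δ_A to the class of that tensor.  A Young permutation is exactly a tuple of permutations of
-- the blocks, so the S_π-coinvariant relations are carried onto the tensor product of the
-- S_{|b_i|}-coinvariant relations, and the average over S_π = ∏ S_{|b_i|} factors into the
-- product of the blockwise averages, which is why φ intertwines the averaged union and
-- intersection.  The inverse ψ reads off the coefficient of A as the product over the blocks of
-- the coefficients of A ∩ b_i.  For the dimension, the S_π-orbits of subsets are classified by
-- the block counts |A ∩ b_i| ∈ {0, …, |b_i|}: sorting every block shows that the indicators of
-- one representative per orbit span, and summing coefficients over an orbit is an S_π-invariant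
-- functional, which separates them.

open import Defs
open import Level using (Level; _⊔_; lift; lower)
open import Algebra.Bundles using (CommutativeMonoid)
import Algebra.Properties.CommutativeMonoid.Sum as FinSum
import Algebra.Properties.CommutativeSemigroup as CommutativeSemigroupProperties
import Algebra.Properties.Ring as RingProperties
import Algebra.Solver.CommutativeMonoid as CMSolver
open import Data.Bool using (Bool; true; false; _∧_; _∨_; not; if_then_else_)
open import Data.Bool.ListAction using (and; all)
open import Data.Bool.Properties using (T-≡; T?; ∧-identityʳ; ∧-zeroʳ) renaming (_≟_ to _≟B_)
open import Data.Empty using (⊥-elim)
open import Data.Fin as Fin using (Fin; zero; suc; toℕ; fromℕ<; punchIn; punchOut)
open import Data.Fin.Permutation as Perm using (Permutation; permutation; _⟨$⟩ʳ_; _⟨$⟩ˡ_; insert)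
open import Data.Fin.Properties
  using (any?; punchOut-injective; injective⇒≤; punchIn-punchOut; suc-injective; toℕ-injective; toℕ-fromℕ<; toℕ<n;
         remQuot-combine; combine-remQuot)
  renaming (_≟_ to _≟F_)
import Data.Fin.Subset as Sub
open import Data.List as List using (List; []; _∷_; _++_; map; concatMap; filterᵇ; allFin; tabulate; lookup; length)
import Data.List.Properties as ListP
open import Data.List.Membership.Propositional using (_∈_)
open import Data.List.Membership.Propositional.Properties using (∈-lookup; ∈-allFin; ∈-filter⁺)
open import Data.List.Relation.Unary.All as All using (All; []; _∷_)
import Data.List.Relation.Unary.All.Properties as AllP
open import Data.List.Relation.Unary.AllPairs using ([]; _∷_)
import Data.List.Relation.Unary.Any as Any
open import Data.List.Relation.Unary.Any using (here; there)
import Data.List.Relation.Unary.Any.Properties as AnyP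
open import Data.List.Relation.Unary.Unique.Propositional using (Unique)
import Data.List.Relation.Unary.Unique.Propositional.Properties as UniqueP
open import Data.Nat as ℕ using (ℕ; zero; suc; z≤n; s≤s)
open import Data.Nat.ListAction using (product)
import Data.Nat.Properties as ℕP
open import Data.Product using (Σ; ∃; _×_; _,_; proj₁; proj₂)
open import Data.Vec as Vec using (Vec; []; _∷_)
import Data.Vec.Properties as VecP
open import Function using (_∘_; id; Equivalence)
open import Function.Definitions using (Injective)
open import Relation.Binary.Definitions using (DecidableEquality)
import Relation.Binary.PropositionalEquality as ≡
open ≡ using (_≡_; _≢_; refl)
import Relation.Binary.Reasoning.Setoid as SetoidReasoning
open import Relation.Nullary using (Dec; yes; no; ¬_)
open import Relation.Nullary.Decidable using (⌊_⌋)

open FinSum ℕP.+-0-commutativeMonoid using () renaming (sum to ∑ℕ; sum-cong-≗ to ∑ℕ-cong-≗; ∑-permute to ∑ℕ-permute)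

private variable
  a b q : Level
  A B : Set a
  n : ℕ

-- Counting in finite enumerations

suc-== : (v x : Fin n) → (suc v == suc x) ≡ (v == x)
suc-== v x with v ≟F x
... | yes refl = refl
... | no _ = refl

count : (A → Bool) → List A → ℕ
count p [] = 0
count p (x ∷ xs) = (if p x then 1 else 0) ℕ.+ count p xs

count-++ : (p : A → Bool) (xs ys : List A) → count p (xs ++ ys) ≡ count p xs ℕ.+ count p ys
count-++ p [] ys = refl
count-++ p (x ∷ xs) ys with p x
... | true = ≡.cong suc (count-++ p xs ys)
... | false = count-++ p xs ys

count-filterᵇ : (q p : A → Bool) (xs : List A) → count p (filterᵇ q xs) ≡ count (λ x → q x ∧ p x) xs
count-filterᵇ q p [] = refl
count-filterᵇ q p (x ∷ xs) with q x
... | true = ≡.cong (_ ℕ.+_) (count-filterᵇ q p xs)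
... | false = count-filterᵇ q p xs

count-cong : (p q : A → Bool) (xs : List A) → All (λ x → p x ≡ q x) xs → count p xs ≡ count q xs
count-cong p q [] [] = refl
count-cong p q (x ∷ xs) (e ∷ es) = ≡.cong₂ (λ b c → (if b then 1 else 0) ℕ.+ c) e (count-cong p q xs es)

count-map : (p : B → Bool) (f : A → B) (xs : List A) → count p (map f xs) ≡ count (p ∘ f) xs
count-map p f [] = refl
count-map p f (x ∷ xs) = ≡.cong (_ ℕ.+_) (count-map p f xs)

count-tabulate : (p : A → Bool) (f : Fin n → A) → count p (tabulate f) ≡ count (p ∘ f) (allFin n)
count-tabulate p f = ≡.trans (≡.cong (count p) (≡.sym (ListP.map-tabulate id f))) (count-map p f (allFin _))

count-concatMap-map : {C : Set a} (p : A → Bool) (q : B → Bool) (r : C → Bool) (pair : A → B → C) →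
  (∀ x y → r (pair x y) ≡ p x ∧ q y) → (xs : List A) (ys : List B) →
  count r (concatMap (λ x → map (pair x) ys) xs) ≡ count p xs ℕ.* count q ys
count-concatMap-map p q r pair h [] ys = refl
count-concatMap-map p q r pair h (x ∷ xs) ys = begin
  count r (map (pair x) ys ++ concatMap (λ x → map (pair x) ys) xs)
    ≡⟨ count-++ r (map (pair x) ys) _ ⟩
  count r (map (pair x) ys) ℕ.+ count r (concatMap (λ x → map (pair x) ys) xs)
    ≡⟨ ≡.cong₂ ℕ._+_ (≡.trans (count-map r (pair x) ys) (count-cong _ _ ys (All.universal (h x) ys)))
                    (count-concatMap-map p q r pair h xs ys) ⟩
  count (λ y → p x ∧ q y) ys ℕ.+ count p xs ℕ.* count q ys
    ≡⟨ ≡.cong (λ z → z ℕ.+ count p xs ℕ.* count q ys) (count-∧ (p x) q ys) ⟩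
  (if p x then count q ys else 0) ℕ.+ count p xs ℕ.* count q ys
    ≡⟨ lemma (p x) ⟩
  count p (x ∷ xs) ℕ.* count q ys ∎
  where
  open ≡.≡-Reasoning
  lemma : ∀ b → (if b then count q ys else 0) ℕ.+ count p xs ℕ.* count q ys ≡ ((if b then 1 else 0) ℕ.+ count p xs) ℕ.* count q ys
  lemma true = refl
  lemma false = refl
  count-∧ : ∀ b (q : B → Bool) ys → count (λ y → b ∧ q y) ys ≡ (if b then count q ys else 0)
  count-∧ true q ys = refl
  count-∧ false q [] = refl
  count-∧ false q (y ∷ ys) = count-∧ false q ys

count-allFin : (x : Fin n) → count (_== x) (allFin n) ≡ 1
count-allFin {suc n} zero = ≡.cong suc (≡.trans (count-tabulate (_== zero) (Fin.suc {n})) (none (allFin n)))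
  where
  none : (xs : List (Fin n)) → count (λ _ → false) xs ≡ 0
  none [] = refl
  none (_ ∷ xs) = none xs
count-allFin {suc n} (suc x) = ≡.trans (count-tabulate (_== suc x) suc)
  (≡.trans (count-cong _ _ (allFin n) (All.universal (λ v → suc-== v x) _)) (count-allFin x))

count≢0⇒∃lookup : (p : A → Bool) (xs : List A) → count p xs ≢ 0 → ∃ λ j → p (lookup xs j) ≡ true
count≢0⇒∃lookup p [] c≢0 = ⊥-elim (c≢0 refl)
count≢0⇒∃lookup p (x ∷ xs) c≢0 with p x in eq
... | true = zero , eq
... | false = let j , e = count≢0⇒∃lookup p xs c≢0 in suc j , e

All-filterᵇ : (p : A → Bool) (xs : List A) → All (λ x → p x ≡ true) (filterᵇ p xs)
All-filterᵇ p xs = All.map (Equivalence.to T-≡) (AllP.all-filter (T? ∘ p) xs)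

All-lookup : {P : A → Set q} {xs : List A} → All P xs → ∀ j → P (lookup xs j)
All-lookup ps j = All.lookup ps (∈-lookup j)

true-iff⇒≡ : {x y : Bool} → (x ≡ true → y ≡ true) → (y ≡ true → x ≡ true) → x ≡ y
true-iff⇒≡ {true} {true} f g = refl
true-iff⇒≡ {true} {false} f g = ≡.sym (f refl)
true-iff⇒≡ {false} {true} f g = g refl
true-iff⇒≡ {false} {false} f g = refl

andF : (Fin n → Bool) → Bool
andF {zero} f = true
andF {suc n} f = f zero ∧ andF (f ∘ suc)

andF⇒ : (f : Fin n → Bool) → andF f ≡ true → ∀ i → f i ≡ true
andF⇒ {suc n} f e i with f zero in eq
andF⇒ {suc n} f e zero | true = eq
andF⇒ {suc n} f e (suc i) | true = andF⇒ (f ∘ suc) e i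

⇒andF : (f : Fin n → Bool) → (∀ i → f i ≡ true) → andF f ≡ true
⇒andF {zero} f h = refl
⇒andF {suc n} f h rewrite h zero = ⇒andF (f ∘ suc) (h ∘ suc)

andF-cong : (f g : Fin n → Bool) → (∀ i → f i ≡ g i) → andF f ≡ andF g
andF-cong {zero} f g h = refl
andF-cong {suc n} f g h = ≡.cong₂ _∧_ (h zero) (andF-cong (f ∘ suc) (g ∘ suc) (h ∘ suc))

module _ {A : Set a} (_≟_ : DecidableEquality A) where

  eqᵇ : A → A → Bool
  eqᵇ x y = ⌊ x ≟ y ⌋

  eqᵇ⇒≡ : ∀ {x y} → eqᵇ x y ≡ true → x ≡ y
  eqᵇ⇒≡ {x} {y} e with x ≟ y
  ... | yes x≡y = x≡y

  ≡⇒eqᵇ : ∀ {x y} → x ≡ y → eqᵇ x y ≡ true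
  ≡⇒eqᵇ {x} {y} x≡y with x ≟ y
  ... | yes _ = refl
  ... | no x≢y = ⊥-elim (x≢y x≡y)

  eqᵇ-sym : ∀ x y → eqᵇ x y ≡ eqᵇ y x
  eqᵇ-sym x y = true-iff⇒≡ (≡⇒eqᵇ ∘ ≡.sym ∘ eqᵇ⇒≡) (≡⇒eqᵇ ∘ ≡.sym ∘ eqᵇ⇒≡)

  eqᶠ : (Fin n → A) → (Fin n → A) → Bool
  eqᶠ f g = andF (λ i → eqᵇ (f i) (g i))

  eqᶠ⇒≗ : {f g : Fin n → A} → eqᶠ f g ≡ true → ∀ i → f i ≡ g i
  eqᶠ⇒≗ e i = eqᵇ⇒≡ (andF⇒ _ e i)

  ≗⇒eqᶠ : {f g : Fin n → A} → (∀ i → f i ≡ g i) → eqᶠ f g ≡ true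
  ≗⇒eqᶠ h = ⇒andF _ (≡⇒eqᵇ ∘ h)

  eqᶠ-sym : (f g : Fin n → A) → eqᶠ f g ≡ eqᶠ g f
  eqᶠ-sym f g = andF-cong _ _ (λ i → eqᵇ-sym (f i) (g i))

==⇒≡ : {x y : Fin n} → x == y ≡ true → x ≡ y
==⇒≡ = eqᵇ⇒≡ _≟F_

≡⇒== : {x y : Fin n} → x ≡ y → x == y ≡ true
≡⇒== = ≡⇒eqᵇ _≟F_

all-allFin : (f : Fin n → Bool) → all f (allFin n) ≡ andF f
all-allFin {n} f = ≡.trans (≡.cong and (ListP.map-tabulate id f)) (go f)
  where
  go : ∀ {n} (f : Fin n → Bool) → and (tabulate f) ≡ andF f
  go {zero} f = refl
  go {suc n} f = ≡.cong (f zero ∧_) (go (f ∘ suc))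

prodF : (Fin n → ℕ) → ℕ
prodF {zero} f = 1
prodF {suc n} f = f zero ℕ.* prodF (f ∘ suc)

prodF-1 : (f : Fin n → ℕ) → (∀ i → f i ≡ 1) → prodF f ≡ 1
prodF-1 {zero} f h = refl
prodF-1 {suc n} f h rewrite h zero = ≡.trans (ℕP.+-identityʳ _) (prodF-1 (f ∘ suc) (h ∘ suc))

product-allFin : (f : Fin n → ℕ) → product (map f (allFin n)) ≡ prodF f
product-allFin {n} f = ≡.trans (≡.cong product (ListP.map-tabulate id f)) (go f)
  where
  go : ∀ {n} (f : Fin n → ℕ) → product (tabulate f) ≡ prodF f
  go {zero} f = refl
  go {suc n} f = ≡.cong (f zero ℕ.*_) (go (f ∘ suc))

cons : {A : Fin (suc n) → Set a} → A zero → ((i : Fin n) → A (suc i)) → (i : Fin (suc n)) → A i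
cons x t zero = x
cons x t (suc i) = t i

tuples : {A : Fin n → Set a} → ((i : Fin n) → List (A i)) → List ((i : Fin n) → A i)
tuples {zero} L = (λ ()) ∷ []
tuples {suc n} L = concatMap (λ x → map (cons x) (tuples (L ∘ suc))) (L zero)

count-tuples : {A : Fin n → Set a} (L : (i : Fin n) → List (A i)) (R : (i : Fin n) → A i → Bool) →
  count (λ t → andF (λ i → R i (t i))) (tuples L) ≡ prodF (λ i → count (R i) (L i))
count-tuples {zero} L R = refl
count-tuples {suc n} L R =
  ≡.trans (count-concatMap-map (R zero) (λ t → andF (λ i → R (suc i) (t i))) _ cons (λ _ _ → refl) (L zero) _)
          (≡.cong (count (R zero) (L zero) ℕ.*_) (count-tuples (L ∘ suc) (R ∘ suc)))

All-tuples : {A : Fin n → Set a} (L : (i : Fin n) → List (A i)) (Q : (i : Fin n) → A i → Set q) →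
  (∀ i → All (Q i) (L i)) → All (λ t → ∀ i → Q i (t i)) (tuples L)
All-tuples {zero} L Q h = (λ ()) ∷ []
All-tuples {suc n} L Q h = AllP.concat⁺ (AllP.map⁺ (All.map (λ qx → AllP.map⁺ (All.map (λ qt → λ { zero → qx ; (suc i) → qt i })
  (All-tuples (L ∘ suc) (Q ∘ suc) (h ∘ suc)))) (h zero)))

count-allFuns : ∀ n m (g : Fin n → Fin m) → count (λ f → eqᶠ _≟F_ f g) (allFuns n m) ≡ 1
count-allFuns zero m g = refl
count-allFuns (suc n) m g =
  ≡.trans (count-concatMap-map (_== g zero) (λ f → eqᶠ _≟F_ f (g ∘ suc)) _ _ (λ _ _ → refl) (allFin m) (allFuns n m))
          (≡.cong₂ ℕ._*_ (count-allFin (g zero)) (count-allFuns n m (g ∘ suc)))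

isPermᵇ-andF : (f : Fin n → Fin n) → isPermᵇ f ≡ andF (λ i → andF (λ j → not (f i == f j) ∨ (i == j)))
isPermᵇ-andF {n} f = ≡.trans (≡.cong and (ListP.map-cong (λ i → all-allFin (λ j → not (f i == f j) ∨ (i == j))) (allFin n)))
                             (all-allFin (λ i → andF (λ j → not (f i == f j) ∨ (i == j))))

isPermᵇ⇒injective : (f : Fin n → Fin n) → isPermᵇ f ≡ true → Injective _≡_ _≡_ f
isPermᵇ⇒injective f e {i} {j} fi≡fj with andF⇒ _ (andF⇒ _ (≡.trans (≡.sym (isPermᵇ-andF f)) e) i) j
... | h rewrite ≡⇒== fi≡fj = ==⇒≡ h

injective⇒isPermᵇ : (f : Fin n → Fin n) → Injective _≡_ _≡_ f → isPermᵇ f ≡ true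
injective⇒isPermᵇ f inj = ≡.trans (isPermᵇ-andF f) (⇒andF _ (λ i → ⇒andF _ (λ j → go i j)))
  where
  go : ∀ i j → not (f i == f j) ∨ (i == j) ≡ true
  go i j with f i ≟F f j
  ... | yes fi≡fj = ≡⇒== (inj fi≡fj)
  ... | no _ = refl

isPermᵇ-cong : (f g : Fin n → Fin n) → (∀ i → f i ≡ g i) → isPermᵇ f ≡ isPermᵇ g
isPermᵇ-cong f g h = ≡.trans (isPermᵇ-andF f) (≡.trans (andF-cong _ _ (λ i → andF-cong _ _ (λ j →
  ≡.cong₂ (λ x y → not (x == y) ∨ (i == j)) (h i) (h j)))) (≡.sym (isPermᵇ-andF g)))

injective⇒surjective : {m : ℕ} (f : Fin m → Fin m) → Injective _≡_ _≡_ f → ∀ j → ∃ λ i → f i ≡ j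
injective⇒surjective {suc m} f inj j with any? (λ i → f i ≟F j)
... | yes found = found
... | no ¬found = ⊥-elim (ℕP.<-irrefl refl (injective⇒≤ punchOut∘f-injective))
  where
  f≢j : ∀ i → j ≢ f i
  f≢j i j≡fi = ¬found (i , ≡.sym j≡fi)
  punchOut∘f-injective : Injective _≡_ _≡_ (λ i → punchOut (f≢j i))
  punchOut∘f-injective e = inj (punchOut-injective (f≢j _) (f≢j _) e)

module _ {m : ℕ} (f : Fin m → Fin m) where

  inverse : Fin m → Fin m
  inverse j with any? (λ i → f i ≟F j)
  ... | yes (i , _) = i
  ... | no _ = j

  module _ (inj : Injective _≡_ _≡_ f) where

    inverseʳ : ∀ j → f (inverse j) ≡ j
    inverseʳ j with any? (λ i → f i ≟F j)
    ... | yes (i , fi≡j) = fi≡j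
    ... | no ¬found = ⊥-elim (¬found (injective⇒surjective f inj j))

    inverseˡ : ∀ i → inverse (f i) ≡ i
    inverseˡ i = inj (inverseʳ (f i))

    inverse-injective : Injective _≡_ _≡_ inverse
    inverse-injective {x} {y} e = ≡.trans (≡.sym (inverseʳ x)) (≡.trans (≡.cong f e) (inverseʳ y))

    toPermutation : Permutation m m
    toPermutation = permutation f inverse inverseʳ inverseˡ

inverse-cong : {m : ℕ} (f g : Fin m → Fin m) → Injective _≡_ _≡_ g → (∀ i → f i ≡ g i) → ∀ j → inverse f j ≡ inverse g j
inverse-cong f g g-inj f≗g j with any? (λ i → f i ≟F j)
... | yes (i , fi≡j) = ≡.trans (≡.sym (inverseˡ g g-inj i)) (≡.cong (inverse g) (≡.trans (≡.sym (f≗g i)) fi≡j))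
... | no ¬found = ⊥-elim (¬found (inverse g j , ≡.trans (f≗g _) (inverseʳ g g-inj j)))

module FilteredFunctions {m : ℕ} (q : (Fin n → Fin m) → Bool) (q-cong : ∀ f g → (∀ i → f i ≡ g i) → q f ≡ q g) where

  members : List (Fin n → Fin m)
  members = filterᵇ q (allFuns n m)

  count-members : ∀ g → q g ≡ true → count (λ f → eqᶠ _≟F_ f g) members ≡ 1
  count-members g qg = ≡.trans (count-filterᵇ q (λ f → eqᶠ _≟F_ f g) (allFuns n m))
    (≡.trans (count-cong _ _ (allFuns n m) (All.universal q∧eqᶠ≡eqᶠ _)) (count-allFuns n m g))
    where
    q∧eqᶠ≡eqᶠ : ∀ f → (q f ∧ eqᶠ _≟F_ f g) ≡ eqᶠ _≟F_ f g
    q∧eqᶠ≡eqᶠ f with eqᶠ _≟F_ f g in e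
    ... | true = ≡.trans (∧-identityʳ _) (≡.trans (q-cong f g (eqᶠ⇒≗ _≟F_ e)) qg)
    ... | false = ∧-zeroʳ _

  -- abstract, so that no type checking problem ever unfolds the enumeration of all functions
  abstract
    lookup-members : ∀ g → q g ≡ true → ∃ λ j → ∀ i → lookup members j i ≡ g i
    lookup-members g qg =
      let j , e = count≢0⇒∃lookup (λ f → eqᶠ _≟F_ f g) members (λ c≡0 → ℕP.1+n≢0 (≡.trans (≡.sym (count-members g qg)) c≡0))
      in j , eqᶠ⇒≗ _≟F_ e

  All-members : All (λ f → q f ≡ true) members
  All-members = All-filterᵇ q (allFuns n m)

module SymmetricGroup (m : ℕ) = FilteredFunctions {m} {m} isPermᵇ isPermᵇ-cong

count-Sym : {m : ℕ} (g : Fin m → Fin m) → Injective _≡_ _≡_ g → count (λ f → eqᶠ _≟F_ f g) (Sym m) ≡ 1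
count-Sym {m} g inj = SymmetricGroup.count-members m g (injective⇒isPermᵇ g inj)

lookup-Sym : {m : ℕ} (g : Fin m → Fin m) → Injective _≡_ _≡_ g → ∃ λ j → ∀ i → lookup (Sym m) j i ≡ g i
lookup-Sym {m} g inj = SymmetricGroup.lookup-members m g (injective⇒isPermᵇ g inj)

All-Sym : ∀ m → All (λ f → Injective _≡_ _≡_ f) (Sym m)
All-Sym m = All.map (λ {f} → isPermᵇ⇒injective f) (SymmetricGroup.All-members m)

-- Blocks of the partition and the Young subgroup

lookup-injective : {xs : List A} → Unique xs → Injective _≡_ _≡_ (lookup xs)
lookup-injective (h ∷ u) {zero} {zero} e = refl
lookup-injective (h ∷ u) {zero} {suc j} e = ⊥-elim (All-lookup h j e)
lookup-injective (h ∷ u) {suc i} {zero} e = ⊥-elim (All-lookup h i (≡.sym e))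
lookup-injective (h ∷ u) {suc i} {suc j} e = ≡.cong suc (lookup-injective u e)

module Blocks {n k : ℕ} (blk : Fin n → Fin k) where

  block : Fin k → List (Fin n)
  block i = filterᵇ (λ x → blk x == i) (allFin n)

  size : Fin k → ℕ
  size i = List.length (block i)

  elem : (i : Fin k) → Fin (size i) → Fin n
  elem i = lookup (block i)

  blk-elem : ∀ i j → blk (elem i j) ≡ i
  blk-elem i j = ==⇒≡ (All-lookup (All-filterᵇ (λ x → blk x == i) (allFin n)) j)

  elem-injective : ∀ i → Injective _≡_ _≡_ (elem i)
  elem-injective i = lookup-injective (UniqueP.filter⁺ (T? ∘ (λ x → blk x == i)) (UniqueP.allFin⁺ n))

  rankIn : (i : Fin k) (x : Fin n) → blk x ≡ i → Fin (size i)
  rankIn i x e = Any.index (∈-filter⁺ (T? ∘ (λ x → blk x == i)) (∈-allFin x) (Equivalence.from T-≡ (≡⇒== e)))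

  elem-rankIn : ∀ i x (e : blk x ≡ i) → elem i (rankIn i x e) ≡ x
  elem-rankIn i x e = ≡.sym (AnyP.lookup-index (∈-filter⁺ (T? ∘ (λ x → blk x == i)) (∈-allFin x) (Equivalence.from T-≡ (≡⇒== e))))

  rank : (x : Fin n) → Fin (size (blk x))
  rank x = rankIn (blk x) x refl

  elem-rank : ∀ x → elem (blk x) (rank x) ≡ x
  elem-rank x = elem-rankIn (blk x) x refl

  Position : Set
  Position = Σ (Fin k) (λ i → Fin (size i))

  position-elem : ∀ i j → _≡_ {A = Position} (blk (elem i j) , rank (elem i j)) (i , j)
  position-elem i j = go (blk-elem i j) (elem-rank (elem i j))
    where
    go : ∀ {i'} {j' : Fin (size i')} → i' ≡ i → elem i' j' ≡ elem i j → _≡_ {A = Position} (i' , j') (i , j)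
    go refl e = ≡.cong (i ,_) (elem-injective i e)

  PerBlock : Set a → Set a
  PerBlock A = (i : Fin k) → Fin (size i) → A

  assemble : PerBlock A → Fin n → A
  assemble B x = B (blk x) (rank x)

  restrict : (Fin n → A) → PerBlock A
  restrict f i j = f (elem i j)

  assemble-restrict : (f : Fin n → A) → ∀ x → assemble (restrict f) x ≡ f x
  assemble-restrict f x = ≡.cong f (elem-rank x)

  restrict-assemble : (B : PerBlock A) → ∀ i j → restrict (assemble B) i j ≡ B i j
  restrict-assemble B i j = ≡.cong (λ p → B (proj₁ p) (proj₂ p)) (position-elem i j)

  IsYoung : (Fin n → Fin n) → Set
  IsYoung g = Injective _≡_ _≡_ g × (∀ x → blk (g x) ≡ blk x)

  BlockPerm : Set
  BlockPerm = (i : Fin k) → Fin (size i) → Fin (size i)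

  blockwise : BlockPerm → Fin n → Fin n
  blockwise τ x = elem (blk x) (τ (blk x) (rank x))

  blockwise-elem : ∀ τ i j → blockwise τ (elem i j) ≡ elem i (τ i j)
  blockwise-elem τ i j = restrict-assemble (λ i j → elem i (τ i j)) i j

  blockwise-cong : ∀ τ τ' → (∀ i j → τ i j ≡ τ' i j) → ∀ x → blockwise τ x ≡ blockwise τ' x
  blockwise-cong τ τ' h x = ≡.cong (elem (blk x)) (h _ _)

  blockwise-young : ∀ τ → (∀ i → Injective _≡_ _≡_ (τ i)) → IsYoung (blockwise τ)
  blockwise-young τ inj = (λ {x} {y} e → ≡.trans (≡.sym (back x)) (≡.trans (≡.cong (blockwise τ⁻¹) e) (back y))) ,
                          (λ x → blk-elem _ _)
    where
    τ⁻¹ : BlockPerm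
    τ⁻¹ i = inverse (τ i)
    back : ∀ x → blockwise τ⁻¹ (blockwise τ x) ≡ x
    back x = ≡.trans (blockwise-elem τ⁻¹ (blk x) _) (≡.trans (≡.cong (elem (blk x)) (inverseˡ (τ (blk x)) (inj (blk x)) _)) (elem-rank x))

  restrictPerm : (Fin n → Fin n) → BlockPerm
  restrictPerm g i j with blk (g (elem i j)) ≟F i
  ... | yes e = rankIn i (g (elem i j)) e
  ... | no _ = j

  elem-restrictPerm : ∀ g → (∀ x → blk (g x) ≡ blk x) → ∀ i j → elem i (restrictPerm g i j) ≡ g (elem i j)
  elem-restrictPerm g g-blk i j with blk (g (elem i j)) ≟F i
  ... | yes e = elem-rankIn i _ e
  ... | no ne = ⊥-elim (ne (≡.trans (g-blk _) (blk-elem i j)))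

  restrictPerm-blockwise : ∀ τ i j → restrictPerm (blockwise τ) i j ≡ τ i j
  restrictPerm-blockwise τ i j =
    elem-injective i (≡.trans (elem-restrictPerm (blockwise τ) (λ x → blk-elem _ _) i j) (blockwise-elem τ i j))

  blockwise-restrictPerm : ∀ g → IsYoung g → ∀ x → blockwise (restrictPerm g) x ≡ g x
  blockwise-restrictPerm g (_ , g-blk) x = ≡.trans (elem-restrictPerm g g-blk (blk x) (rank x)) (≡.cong g (elem-rank x))

  restrictPerm-injective : ∀ g → IsYoung g → ∀ i → Injective _≡_ _≡_ (restrictPerm g i)
  restrictPerm-injective g (g-inj , g-blk) i e = elem-injective i (g-inj
    (≡.trans (≡.sym (elem-restrictPerm g g-blk i _)) (≡.trans (≡.cong (elem i) e) (elem-restrictPerm g g-blk i _))))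

  restrictPerm-cong : ∀ g g' → (∀ x → g x ≡ g' x) → ∀ i j → restrictPerm g i j ≡ restrictPerm g' i j
  restrictPerm-cong g g' h i j with blk (g (elem i j)) ≟F i | blk (g' (elem i j)) ≟F i
  ... | yes e | yes e' = elem-injective i (≡.trans (elem-rankIn i _ e) (≡.trans (h _) (≡.sym (elem-rankIn i _ e'))))
  ... | yes e | no ne' = ⊥-elim (ne' (≡.trans (≡.sym (≡.cong blk (h _))) e))
  ... | no ne | yes e' = ⊥-elim (ne (≡.trans (≡.cong blk (h _)) e'))
  ... | no _ | no _ = refl

  assemble-young : (B : PerBlock A) → ∀ g → IsYoung g → ∀ x → assemble B (g x) ≡ assemble (λ i j → B i (restrictPerm g i j)) x
  assemble-young B g (_ , g-blk) x = ≡.trans (≡.cong (assemble B ∘ g) (≡.sym (elem-rank x)))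
    (≡.trans (≡.cong (assemble B) (≡.sym (elem-restrictPerm g g-blk (blk x) (rank x))))
             (≡.cong (λ p → B (proj₁ p) (proj₂ p)) (position-elem (blk x) (restrictPerm g (blk x) (rank x)))))

  isYoungᵇ : (Fin n → Fin n) → Bool
  isYoungᵇ σ = isPermᵇ σ ∧ all (λ x → blk (σ x) == blk x) (allFin n)

  isYoungᵇ-cong : ∀ f g → (∀ x → f x ≡ g x) → isYoungᵇ f ≡ isYoungᵇ g
  isYoungᵇ-cong f g h = ≡.cong₂ _∧_ (isPermᵇ-cong f g h) (≡.cong and (ListP.map-cong (λ x → ≡.cong (λ y → blk y == blk x) (h x)) (allFin n)))

  isYoungᵇ⇔IsYoung : ∀ g → (isYoungᵇ g ≡ true → IsYoung g) × (IsYoung g → isYoungᵇ g ≡ true)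
  isYoungᵇ⇔IsYoung g = (λ e → let p , b = ∧-true e in isPermᵇ⇒injective g p , λ x → ==⇒≡ (andF⇒ _ (≡.trans (≡.sym (all-allFin (λ x → blk (g x) == blk x))) b) x))
                     , (λ (g-inj , g-blk) → ≡.cong₂ _∧_ (injective⇒isPermᵇ g g-inj) (≡.trans (all-allFin (λ x → blk (g x) == blk x)) (⇒andF _ (≡⇒== ∘ g-blk))))
    where
    ∧-true : ∀ {x y} → x ∧ y ≡ true → x ≡ true × y ≡ true
    ∧-true {true} {true} _ = refl , refl

  module YoungGroup = FilteredFunctions {n} {n} isYoungᵇ isYoungᵇ-cong

  All-Young : All IsYoung (Young blk)
  All-Young = All.map (proj₁ (isYoungᵇ⇔IsYoung _)) YoungGroup.All-members

  count-Young : ∀ g → IsYoung g → count (λ f → eqᶠ _≟F_ f g) (Young blk) ≡ 1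
  count-Young g yg = YoungGroup.count-members g (proj₂ (isYoungᵇ⇔IsYoung g) yg)

  lookup-Young : ∀ g → IsYoung g → ∃ λ j → ∀ x → lookup (Young blk) j x ≡ g x
  lookup-Young g yg = YoungGroup.lookup-members g (proj₂ (isYoungᵇ⇔IsYoung g) yg)

bools : List Bool
bools = false ∷ true ∷ []

count-bools : ∀ b → count (λ x → eqᵇ _≟B_ x b) bools ≡ 1
count-bools false = refl
count-bools true = refl

_≟V_ : DecidableEquality (Vec Bool n)
_≟V_ = VecP.≡-dec _≟B_

eqᵇ-∷ : (b c : Bool) (s r : Vec Bool n) → eqᵇ _≟V_ (b ∷ s) (c ∷ r) ≡ eqᵇ _≟V_ s r ∧ eqᵇ _≟B_ b c
eqᵇ-∷ b c s r = true-iff⇒≡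
  (λ e → let b≡c , s≡r = VecP.∷-injective (eqᵇ⇒≡ _≟V_ e) in ≡.cong₂ _∧_ (≡⇒eqᵇ _≟V_ s≡r) (≡⇒eqᵇ _≟B_ b≡c))
  (λ e → ≡⇒eqᵇ _≟V_ (≡.cong₂ _∷_ (eqᵇ⇒≡ _≟B_ (∧-elimʳ _ e)) (eqᵇ⇒≡ _≟V_ (∧-elimˡ e))))
  where
  ∧-elimˡ : ∀ {x y} → x ∧ y ≡ true → x ≡ true
  ∧-elimˡ {true} e = refl
  ∧-elimʳ : ∀ x {y} → x ∧ y ≡ true → y ≡ true
  ∧-elimʳ true e = e

count-allSubsets : ∀ n (s : Vec Bool n) → count (λ x → eqᵇ _≟V_ x s) (allSubsets n) ≡ 1
count-allSubsets zero [] = refl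
count-allSubsets (suc n) (b ∷ s) =
  ≡.trans (count-concatMap-map (λ r → eqᵇ _≟V_ r s) (λ c → eqᵇ _≟B_ c b) _ (λ r c → c ∷ r) (λ r c → eqᵇ-∷ c b r s) (allSubsets n) bools)
          (≡.cong₂ ℕ._*_ (count-allSubsets n s) (count-bools b))

-- Sorting a block

countᶠ : {m : ℕ} → (Fin m → Bool) → ℕ
countᶠ β = ∑ℕ (λ j → if β j then 1 else 0)

countᶠ-≤ : {m : ℕ} (β : Fin m → Bool) → countᶠ β ℕ.≤ m
countᶠ-≤ {zero} β = z≤n
countᶠ-≤ {suc m} β with β zero
... | true = s≤s (countᶠ-≤ (β ∘ suc))
... | false = ℕP.m≤n⇒m≤1+n (countᶠ-≤ (β ∘ suc))

countᶠ-cong : {m : ℕ} (β β' : Fin m → Bool) → (∀ j → β j ≡ β' j) → countᶠ β ≡ countᶠ β'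
countᶠ-cong β β' h = ∑ℕ-cong-≗ (λ j → ≡.cong (if_then 1 else 0) (h j))

countᶠ-permute : {m : ℕ} (β : Fin m → Bool) (π : Permutation m m) → countᶠ (λ j → β (π ⟨$⟩ʳ j)) ≡ countᶠ β
countᶠ-permute β π = ≡.sym (∑ℕ-permute (λ j → if β j then 1 else 0) π)

leading : {m : ℕ} → ℕ → Fin m → Bool
leading zero j = false
leading (suc c) zero = true
leading (suc c) (suc j) = leading c j

countᶠ-leading : {m : ℕ} (c : ℕ) → c ℕ.≤ m → countᶠ {m} (leading c) ≡ c
countᶠ-leading {zero} zero z≤n = refl
countᶠ-leading {suc m} zero z≤n = countᶠ-leading {m} zero z≤n
countᶠ-leading {suc m} (suc c) (s≤s c≤m) = ≡.cong suc (countᶠ-leading c c≤m)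

leading-punchIn : {m : ℕ} (c : ℕ) (p : Fin (suc m)) → toℕ p ≡ c →
  leading c p ≡ false × (∀ k → leading c (punchIn p k) ≡ leading c k)
leading-punchIn zero p _ = refl , λ _ → refl
leading-punchIn {zero} (suc c) (suc ()) _
leading-punchIn {suc m} (suc c) (suc p) e =
  let at-p , off-p = leading-punchIn c p (ℕP.suc-injective e)
  in at-p , λ { zero → refl ; (suc k) → off-p k }

insert-sorts : {m : ℕ} (β : Fin (suc m) → Bool) (π : Permutation m m) (c C : ℕ) (p : Fin (suc m)) →
  (∀ k → β (suc (π ⟨$⟩ʳ k)) ≡ leading c k) → β zero ≡ leading C p → (∀ k → leading C (punchIn p k) ≡ leading c k) →
  ∀ j → β (insert p zero π ⟨$⟩ʳ j) ≡ leading C j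
insert-sorts {m} β π c C p π-sorts at-p off-p j with p ≟F j
... | yes refl = at-p
... | no p≢j = ≡.trans (π-sorts k) (≡.trans (≡.sym (off-p k)) (≡.cong (leading C) (punchIn-punchOut p≢j)))
  where
  k : Fin m
  k = punchOut p≢j

sort : {m : ℕ} (β : Fin m → Bool) → ∃ λ (π : Permutation m m) → ∀ j → β (π ⟨$⟩ʳ j) ≡ leading (countᶠ β) j
sort {zero} β = Perm.id , λ ()
sort {suc m} β with sort (β ∘ suc) | β zero in β₀
... | π , π-sorts | true = insert zero zero π , insert-sorts β π (countᶠ (β ∘ suc)) (suc (countᶠ (β ∘ suc))) zero π-sorts β₀ (λ _ → refl)
... | π , π-sorts | false =
  let c≤m = countᶠ-≤ (β ∘ suc)
      at-p , off-p = leading-punchIn (countᶠ (β ∘ suc)) (fromℕ< (s≤s c≤m)) (toℕ-fromℕ< (s≤s c≤m))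
  in insert (fromℕ< (s≤s c≤m)) zero π , insert-sorts β π (countᶠ (β ∘ suc)) (countᶠ (β ∘ suc)) _ π-sorts (≡.trans β₀ (≡.sym at-p)) off-p

module _ {k : ℕ} {F : Fin k → ℕ} where

  eqΠ : ((i : Fin k) → Fin (F i)) → ((i : Fin k) → Fin (F i)) → Bool
  eqΠ c c' = andF (λ i → c i == c' i)

  eqΠ⇒≗ : {c c' : (i : Fin k) → Fin (F i)} → eqΠ c c' ≡ true → ∀ i → c i ≡ c' i
  eqΠ⇒≗ e i = ==⇒≡ (andF⇒ _ e i)

  ≗⇒eqΠ : {c c' : (i : Fin k) → Fin (F i)} → (∀ i → c i ≡ c' i) → eqΠ c c' ≡ true
  ≗⇒eqΠ h = ⇒andF _ (≡⇒== ∘ h)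

  eqΠ-sym : (c c' : (i : Fin k) → Fin (F i)) → eqΠ c c' ≡ eqΠ c' c
  eqΠ-sym c c' = andF-cong _ _ (λ i → eqᵇ-sym _≟F_ (c i) (c' i))

decode : {k : ℕ} (F : Fin k → ℕ) → Fin (prodF F) → (i : Fin k) → Fin (F i)
decode {zero} F x ()
decode {suc k} F x = cons (proj₁ (Fin.remQuot {F zero} (prodF (F ∘ suc)) x)) (decode (F ∘ suc) (proj₂ (Fin.remQuot {F zero} (prodF (F ∘ suc)) x)))

encode : {k : ℕ} (F : Fin k → ℕ) → ((i : Fin k) → Fin (F i)) → Fin (prodF F)
encode {zero} F c = zero
encode {suc k} F c = Fin.combine (c zero) (encode (F ∘ suc) (c ∘ suc))

encode-cong : {k : ℕ} (F : Fin k → ℕ) {c c' : (i : Fin k) → Fin (F i)} → (∀ i → c i ≡ c' i) → encode F c ≡ encode F c'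
encode-cong {zero} F h = refl
encode-cong {suc k} F h = ≡.cong₂ Fin.combine (h zero) (encode-cong (F ∘ suc) (h ∘ suc))

decode-encode : {k : ℕ} (F : Fin k → ℕ) (c : (i : Fin k) → Fin (F i)) → ∀ i → decode F (encode F c) i ≡ c i
decode-encode {suc k} F c = go _ (remQuot-combine {n = F zero} {k = prodF (F ∘ suc)} (c zero) (encode (F ∘ suc) (c ∘ suc)))
  where
  go : ∀ rq → rq ≡ (c zero , encode (F ∘ suc) (c ∘ suc)) → ∀ i → cons (proj₁ rq) (decode (F ∘ suc) (proj₂ rq)) i ≡ c i
  go _ refl zero = refl
  go _ refl (suc i) = decode-encode (F ∘ suc) (c ∘ suc) i

encode-decode : {k : ℕ} (F : Fin k → ℕ) (x : Fin (prodF F)) → encode F (decode F x) ≡ x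
encode-decode {zero} F zero = refl
encode-decode {suc k} F x =
  ≡.trans (≡.cong (Fin.combine {F zero} _) (encode-decode (F ∘ suc) _)) (combine-remQuot {n = F zero} (prodF (F ∘ suc)) x)

count-decode : {k : ℕ} (F : Fin k → ℕ) (c : (i : Fin k) → Fin (F i)) →
  count (λ x → eqΠ (decode F x) c) (allFin (prodF F)) ≡ 1
count-decode F c = ≡.trans (count-cong _ (_== encode F c) (allFin (prodF F)) (All.universal decodes-to-c _)) (count-allFin (encode F c))
  where
  decodes-to-c : ∀ x → eqΠ (decode F x) c ≡ (x == encode F c)
  decodes-to-c x = true-iff⇒≡
    (λ e → ≡⇒== (≡.trans (≡.sym (encode-decode F x)) (encode-cong F (eqΠ⇒≗ e))))
    (λ e → ≗⇒eqΠ (λ i → ≡.trans (≡.cong (λ y → decode F y i) (==⇒≡ e)) (decode-encode F c i)))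

module _ {k : ℕ} {F : Fin k → Set a} (t : (i : Fin k) → F i) (i : Fin k) (u : F i) where

  update-same : update t i u i ≡ u
  update-same with i ≟F i
  ... | yes refl = refl
  ... | no i≢i = ⊥-elim (i≢i refl)

  update-other : ∀ j → j ≢ i → update t i u j ≡ t j
  update-other j j≢i with j ≟F i
  ... | yes j≡i = ⊥-elim (j≢i j≡i)
  ... | no _ = refl

permuteVec : Vec Bool n → (Fin n → Fin n) → Vec Bool n
permuteVec X g = Vec.tabulate (λ j → Vec.lookup X (g j))

eqᵇ-permuteVec : (g : Fin n → Fin n) → Injective _≡_ _≡_ g → ∀ X A → eqᵇ _≟V_ (permuteVec X g) (permuteVec A g) ≡ eqᵇ _≟V_ X A
eqᵇ-permuteVec g g-inj X A = true-iff⇒≡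
  (λ e → ≡⇒eqᵇ _≟V_ (≡.trans (≡.sym (VecP.tabulate∘lookup X)) (≡.trans (VecP.tabulate-cong (at-all (eqᵇ⇒≡ _≟V_ e))) (VecP.tabulate∘lookup A))))
  (λ e → ≡⇒eqᵇ _≟V_ (≡.cong (λ Y → permuteVec Y g) (eqᵇ⇒≡ _≟V_ e)))
  where
  at-all : permuteVec X g ≡ permuteVec A g → ∀ x → Vec.lookup X x ≡ Vec.lookup A x
  at-all e x = begin
    Vec.lookup X x                                   ≡⟨ ≡.cong (Vec.lookup X) (inverseʳ g g-inj x) ⟨
    Vec.lookup X (g (inverse g x))                   ≡⟨ VecP.lookup∘tabulate _ (inverse g x) ⟨
    Vec.lookup (permuteVec X g) (inverse g x)        ≡⟨ ≡.cong (λ Y → Vec.lookup Y (inverse g x)) e ⟩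
    Vec.lookup (permuteVec A g) (inverse g x)        ≡⟨ VecP.lookup∘tabulate _ (inverse g x) ⟩
    Vec.lookup A (g (inverse g x))                   ≡⟨ ≡.cong (Vec.lookup A) (inverseʳ g g-inj x) ⟩
    Vec.lookup A x                                   ∎
    where open ≡.≡-Reasoning

-- Finite sums

module ListSum {c ℓ} (M : CommutativeMonoid c ℓ) where
  open CommutativeMonoid M renaming (Carrier to C; refl to ≈-refl)
  open SetoidReasoning setoid
  open CMSolver M using (solve; _⊕_; _⊜_)

  ∑ : List A → (A → C) → C
  ∑ xs f = List.foldr (λ x s → f x ∙ s) ε xs

  ∑-cong : (xs : List A) {f g : A → C} → (∀ x → f x ≈ g x) → ∑ xs f ≈ ∑ xs g
  ∑-cong [] h = ≈-refl
  ∑-cong (x ∷ xs) h = ∙-cong (h x) (∑-cong xs h)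

  ∑-cong-All : {xs : List A} {f g : A → C} → All (λ x → f x ≈ g x) xs → ∑ xs f ≈ ∑ xs g
  ∑-cong-All [] = ≈-refl
  ∑-cong-All (h ∷ hs) = ∙-cong h (∑-cong-All hs)

  ∑-++ : (xs ys : List A) (f : A → C) → ∑ (xs ++ ys) f ≈ ∑ xs f ∙ ∑ ys f
  ∑-++ [] ys f = sym (identityˡ _)
  ∑-++ (x ∷ xs) ys f = trans (∙-congˡ (∑-++ xs ys f)) (sym (assoc _ _ _))

  ∑-ε : (xs : List A) → ∑ xs (λ _ → ε) ≈ ε
  ∑-ε [] = ≈-refl
  ∑-ε (x ∷ xs) = trans (identityˡ _) (∑-ε xs)

  ∑-∙ : (xs : List A) (f g : A → C) → ∑ xs (λ x → f x ∙ g x) ≈ ∑ xs f ∙ ∑ xs g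
  ∑-∙ [] f g = sym (identityˡ _)
  ∑-∙ (x ∷ xs) f g = trans (∙-congˡ (∑-∙ xs f g))
    (solve 4 (λ a b c d → (a ⊕ b) ⊕ (c ⊕ d) ⊜ (a ⊕ c) ⊕ (b ⊕ d)) ≈-refl (f x) (g x) (∑ xs f) (∑ xs g))

  ∑-map : (h : A → B) (xs : List A) (f : B → C) → ∑ (map h xs) f ≡ ∑ xs (f ∘ h)
  ∑-map h [] f = ≡.refl
  ∑-map h (x ∷ xs) f = ≡.cong (_ ∙_) (∑-map h xs f)

  ∑-concatMap : (h : A → List B) (xs : List A) (f : B → C) → ∑ (concatMap h xs) f ≈ ∑ xs (λ x → ∑ (h x) f)
  ∑-concatMap h [] f = ≈-refl
  ∑-concatMap h (x ∷ xs) f = trans (∑-++ (h x) (concatMap h xs) f) (∙-congˡ (∑-concatMap h xs f))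

  ∑-swap : (xs : List A) (ys : List B) (f : A → B → C) → ∑ xs (λ x → ∑ ys (f x)) ≈ ∑ ys (λ y → ∑ xs (λ x → f x y))
  ∑-swap [] ys f = sym (∑-ε ys)
  ∑-swap (x ∷ xs) ys f = trans (∙-congˡ (∑-swap xs ys f)) (sym (∑-∙ ys (f x) _))

  ∑-indicator : (p : A → Bool) (xs : List A) (X : C) → count p xs ≡ 1 → ∑ xs (λ x → if p x then X else ε) ≈ X
  ∑-indicator p xs X = go xs
    where
    none : ∀ xs → count p xs ≡ 0 → ∑ xs (λ x → if p x then X else ε) ≈ ε
    none [] _ = ≈-refl
    none (x ∷ xs) c with p x
    ... | false = trans (identityˡ _) (none xs c)
    go : ∀ xs → count p xs ≡ 1 → ∑ xs (λ x → if p x then X else ε) ≈ X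
    go (x ∷ xs) c with p x
    ... | true = trans (∙-congˡ (none xs (ℕP.suc-injective c))) (identityʳ _)
    ... | false = trans (identityˡ _) (go xs c)

  ∑-reindex : (xs : List A) (ys : List B) (R : A → B → Bool) (F : A → C) (G : B → C) →
    All (λ x → count (R x) ys ≡ 1) xs → All (λ y → count (λ x → R x y) xs ≡ 1) ys →
    All (λ x → All (λ y → R x y ≡ true → F x ≈ G y) ys) xs →
    ∑ xs F ≈ ∑ ys G
  ∑-reindex xs ys R F G unique-y unique-x F≈G = begin
    ∑ xs F                                               ≈⟨ ∑-cong-All (All.map (λ {x} → ∑-indicator (R x) ys (F x)) unique-y) ⟨
    ∑ xs (λ x → ∑ ys (λ y → if R x y then F x else ε))   ≈⟨ ∑-cong-All (All.map (λ F≈G → ∑-cong-All (All.map (pick _ _ _) F≈G)) F≈G) ⟩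
    ∑ xs (λ x → ∑ ys (λ y → if R x y then G y else ε))   ≈⟨ ∑-swap xs ys _ ⟩
    ∑ ys (λ y → ∑ xs (λ x → if R x y then G y else ε))   ≈⟨ ∑-cong-All (All.map (λ {y} → ∑-indicator (λ x → R x y) xs (G y)) unique-x) ⟩
    ∑ ys G                                               ∎
    where
    pick : ∀ b (X Y : C) → (b ≡ true → X ≈ Y) → (if b then X else ε) ≈ (if b then Y else ε)
    pick true X Y h = h ≡.refl
    pick false X Y h = ≈-refl

module FieldFacts {c ℓ} (K : Field c ℓ) where
  open Field K public hiding (zero) renaming (refl to ≈-refl)
  open FieldOps K public using (ι)
  open SetoidReasoning setoid public
  open ListSum +-commutativeMonoid public
  open FinSum *-commutativeMonoid public using () renaming (sum to ∏; sum-cong-≋ to ∏-cong; ∑-permute to ∏-permute; ∑-distrib-+ to ∏-distrib-*)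
  open CommutativeSemigroupProperties *-commutativeSemigroup public using (x∙yz≈y∙xz)
  private module RP = RingProperties ring
  private module +-Solver = CMSolver +-commutativeMonoid

  ≡⇒≈ : ∀ {x y} → x ≡ y → x ≈ y
  ≡⇒≈ refl = ≈-refl

  [_] : Bool → Carrier
  [ b ] = if b then 1# else 0#

  [∧] : ∀ x y → [ x ∧ y ] ≈ [ x ] * [ y ]
  [∧] true y = sym (*-identityˡ _)
  [∧] false y = sym (zeroˡ _)

  ∏-indicator : ∀ {n} (p : Fin n → Bool) → ∏ (λ i → [ p i ]) ≈ [ andF p ]
  ∏-indicator {zero} p = ≈-refl
  ∏-indicator {suc n} p = trans (*-congˡ (∏-indicator (p ∘ suc))) (sym ([∧] (p zero) _))

  ∏-1 : ∀ n → ∏ {n} (λ _ → 1#) ≈ 1#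
  ∏-1 zero = ≈-refl
  ∏-1 (suc n) = trans (*-identityˡ _) (∏-1 n)

  ∏-punch : ∀ {n} (g : Fin n → Carrier) i → ∏ g ≈ g i * ∏ (λ j → if j == i then 1# else g j)
  ∏-punch {suc n} g zero = *-congˡ (sym (*-identityˡ _))
  ∏-punch {suc n} g (suc i) = begin
    g zero * ∏ (g ∘ suc)                                                  ≈⟨ *-congˡ (∏-punch (g ∘ suc) i) ⟩
    g zero * (g (suc i) * ∏ (λ j → if j == i then 1# else g (suc j)))     ≈⟨ x∙yz≈y∙xz _ _ _ ⟩
    g (suc i) * (g zero * ∏ (λ j → if j == i then 1# else g (suc j)))     ≈⟨ *-congˡ (*-congˡ (∏-cong (λ j → ≡⇒≈ (≡.cong (if_then 1# else g (suc j)) (≡.sym (suc-== j i)))))) ⟩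
    g (suc i) * (g zero * ∏ (λ j → if suc j == suc i then 1# else g (suc j))) ∎

  ∏-update : ∀ {k} {W : Fin k → Set a} (F : (j : Fin k) → W j → Carrier) (t : (j : Fin k) → W j) i u →
    ∏ (λ j → F j (update t i u j)) ≈ F i u * ∏ (λ j → if j == i then 1# else F j (t j))
  ∏-update F t i u = trans (∏-punch _ i) (*-cong (≡⇒≈ (≡.cong (F i) (update-same t i u))) (∏-cong others))
    where
    others : ∀ j → (if j == i then 1# else F j (update t i u j)) ≈ (if j == i then 1# else F j (t j))
    others j with j ≟F i
    ... | yes _ = ≈-refl
    ... | no _ = ≈-refl

  ∑-distribˡ : (xs : List A) (x : Carrier) (f : A → Carrier) → x * ∑ xs f ≈ ∑ xs (λ y → x * f y)
  ∑-distribˡ [] x f = zeroʳ x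
  ∑-distribˡ (y ∷ xs) x f = trans (distribˡ x (f y) _) (+-congˡ (∑-distribˡ xs x f))

  ∑-distribʳ : (xs : List A) (x : Carrier) (f : A → Carrier) → ∑ xs f * x ≈ ∑ xs (λ y → f y * x)
  ∑-distribʳ xs x f = trans (*-comm _ x) (trans (∑-distribˡ xs x f) (∑-cong xs (λ y → *-comm x (f y))))

  ∑-select : (xs : List A) (p : A → Bool) (f : A → Carrier) (y : Carrier) → count p xs ≡ 1 →
    (∀ x → p x ≡ true → f x ≈ y) → ∑ xs (λ x → [ p x ] * f x) ≈ y
  ∑-select xs p f y c h = trans (∑-cong xs select) (∑-indicator p xs y c)
    where
    select : ∀ x → [ p x ] * f x ≈ (if p x then y else 0#)
    select x with p x in e
    ... | true = trans (*-identityˡ _) (h x e)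
    ... | false = zeroˡ _

  ∑-1 : (xs : List A) → ∑ xs (λ _ → 1#) ≈ ι (length xs)
  ∑-1 [] = ≈-refl
  ∑-1 (x ∷ xs) = +-congˡ (∑-1 xs)

  ∑-tuples : ∀ {k} {W : Fin k → Set a} (L : (i : Fin k) → List (W i)) (f : (i : Fin k) → W i → Carrier) →
    ∑ (tuples L) (λ t → ∏ (λ i → f i (t i))) ≈ ∏ (λ i → ∑ (L i) (f i))
  ∑-tuples {k = zero} L f = +-identityʳ _
  ∑-tuples {k = suc k} {W} L f = begin
    ∑ (concatMap (λ x → map (cons x) T) (L zero)) G                       ≈⟨ ∑-concatMap _ (L zero) G ⟩
    ∑ (L zero) (λ x → ∑ (map (cons x) T) G)                               ≈⟨ ∑-cong (L zero) (λ x → ≡⇒≈ (∑-map (cons x) T G)) ⟩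
    ∑ (L zero) (λ x → ∑ T (λ t → f zero x * ∏ (λ i → f (suc i) (t i))))  ≈⟨ ∑-cong (L zero) (λ x → sym (∑-distribˡ T (f zero x) _)) ⟩
    ∑ (L zero) (λ x → f zero x * ∑ T (λ t → ∏ (λ i → f (suc i) (t i))))  ≈⟨ ∑-cong (L zero) (λ x → *-congˡ (∑-tuples (L ∘ suc) (f ∘ suc))) ⟩
    ∑ (L zero) (λ x → f zero x * ∏ (λ i → ∑ (L (suc i)) (f (suc i))))    ≈⟨ ∑-distribʳ (L zero) _ (f zero) ⟨
    ∑ (L zero) (f zero) * ∏ (λ i → ∑ (L (suc i)) (f (suc i)))            ∎
    where
    T : List ((i : Fin k) → W (suc i))
    T = tuples (L ∘ suc)
    G : ((i : Fin (suc k)) → W i) → Carrier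
    G t = ∏ (λ i → f i (t i))

  inverse-unique : ∀ x y → ¬ (x ≈ 0#) → x * y ≈ 1# → y ≈ x ⁻¹
  inverse-unique x y x≉0 xy≈1 = begin
    y                ≈⟨ *-identityʳ y ⟨
    y * 1#           ≈⟨ *-congˡ (⁻¹-inverseʳ x x≉0) ⟨
    y * (x * x ⁻¹)   ≈⟨ *-assoc y x _ ⟨
    (y * x) * x ⁻¹   ≈⟨ *-congʳ (trans (*-comm y x) xy≈1) ⟩
    1# * x ⁻¹        ≈⟨ *-identityˡ _ ⟩
    x ⁻¹             ∎

  -- the pointwise form of SetAlg._-_ on ⟨P⟩, where u - v = u + (- 1#) · v
  infixl 6 _⊖_
  _⊖_ : Carrier → Carrier → Carrier
  x ⊖ y = x + (- 1#) * y

  ⊖-cong : ∀ {x x' y y'} → x ≈ x' → y ≈ y' → x ⊖ y ≈ x' ⊖ y'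
  ⊖-cong p q = +-cong p (*-congˡ q)

  x⊖x≈0 : ∀ x → x ⊖ x ≈ 0#
  x⊖x≈0 x = trans (+-congˡ (RP.-1*x≈-x x)) (-‿inverseʳ x)

  +-⊖ : ∀ x y → y + (x ⊖ y) ≈ x
  +-⊖ x y = begin
    y + (x ⊖ y)        ≈⟨ +-Solver.solve 3 (λ a b c → b +-Solver.⊕ (a +-Solver.⊕ c) +-Solver.⊜ a +-Solver.⊕ (b +-Solver.⊕ c)) ≈-refl x y ((- 1#) * y) ⟩
    x + (y ⊖ y)        ≈⟨ +-congˡ (x⊖x≈0 y) ⟩
    x + 0#             ≈⟨ +-identityʳ x ⟩
    x                  ∎

  ⊖≈0⇒≈ : ∀ x y → x ⊖ y ≈ 0# → x ≈ y
  ⊖≈0⇒≈ x y h = trans (sym (+-⊖ x y)) (trans (+-congˡ h) (+-identityʳ y))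

  ⊖-+-⊖ : ∀ x y z → (x ⊖ y) + (y ⊖ z) ≈ x ⊖ z
  ⊖-+-⊖ x y z = trans (+-Solver.solve 4 (λ a b c d → (a +-Solver.⊕ b) +-Solver.⊕ (c +-Solver.⊕ d) +-Solver.⊜ (a +-Solver.⊕ d) +-Solver.⊕ (c +-Solver.⊕ b)) ≈-refl x ((- 1#) * y) y ((- 1#) * z))
                      (trans (+-congˡ (x⊖x≈0 y)) (+-identityʳ _))

  ⊖-distrib-+ : ∀ x x' y y' → (x + x') ⊖ (y + y') ≈ (x ⊖ y) + (x' ⊖ y')
  ⊖-distrib-+ x x' y y' = trans (+-congˡ (distribˡ (- 1#) y y'))
    (+-Solver.solve 4 (λ a b c d → (a +-Solver.⊕ b) +-Solver.⊕ (c +-Solver.⊕ d) +-Solver.⊜ (a +-Solver.⊕ c) +-Solver.⊕ (b +-Solver.⊕ d)) ≈-refl x x' ((- 1#) * y) ((- 1#) * y'))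

  *-distribˡ-⊖ : ∀ a x y → a * (x ⊖ y) ≈ a * x ⊖ a * y
  *-distribˡ-⊖ a x y = trans (distribˡ a x _) (+-congˡ (x∙yz≈y∙xz a (- 1#) y))

  ⊖-swap : ∀ x y → y ⊖ x ≈ (- 1#) * (x ⊖ y)
  ⊖-swap x y = sym (trans (*-distribˡ-⊖ (- 1#) x y) (trans (+-congˡ -1*-1*y≈y) (+-comm _ _)))
    where
    -1*-1*y≈y : (- 1#) * ((- 1#) * y) ≈ y
    -1*-1*y≈y = trans (RP.-1*x≈-x _) (trans (-‿cong (RP.-1*x≈-x y)) (RP.-‿involutive y))

-- Tensor products

module TensorFacts {c ℓ} (K : Field c ℓ) {k : ℕ} (W : Fin k → SetAlg K) where
  open FieldFacts K
  open Tensor K W public using (Tup; Term; _~_; ~refl; ~sym; ~trans; ~++; ~swap; ~coef; ~slot; ~zero; ~addc; ~adds; ~scal; bilinT)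
  open SetAlg using () renaming (_≈_ to _≈W_; _+_ to _+W_; _·_ to _·W_)

  ≡⇒~ : ∀ {s t} → s ≡ t → s ~ t
  ≡⇒~ refl = ~refl

  Term-commutativeMonoid : CommutativeMonoid c (c ⊔ ℓ)
  Term-commutativeMonoid = record
    { Carrier = Term ; _≈_ = _~_ ; _∙_ = _++_ ; ε = []
    ; isCommutativeMonoid = record
      { isMonoid = record
        { isSemigroup = record
          { isMagma = record { isEquivalence = record { refl = ~refl ; sym = ~sym ; trans = ~trans } ; ∙-cong = ~++ }
          ; assoc = λ x y z → ≡⇒~ (ListP.++-assoc x y z) }
        ; identity = (λ x → ~refl) , (λ x → ≡⇒~ (ListP.++-identityʳ x)) }
      ; comm = ~swap } }

  module ∑ᵗ = ListSum Term-commutativeMonoid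
  open ∑ᵗ public using () renaming (∑ to ∑ᵗ)
  open CMSolver Term-commutativeMonoid using (solve; _⊕_; _⊜_)

  singletons : (s : Term) → s ≡ ∑ᵗ s (λ p → p ∷ [])
  singletons [] = refl
  singletons (p ∷ s) = ≡.cong (p ∷_) (singletons s)

  ∑ᵗ-∷[] : {X : Set a} (xs : List X) (h : X → Carrier × Tup) → ∑ᵗ xs (λ x → h x ∷ []) ≡ map h xs
  ∑ᵗ-∷[] [] h = refl
  ∑ᵗ-∷[] (x ∷ xs) h = ≡.cong (h x ∷_) (∑ᵗ-∷[] xs h)

  infixr 25 _·ᵗ_
  _·ᵗ_ : Carrier → Term → Term
  a ·ᵗ s = map (λ p → (a * proj₁ p , proj₂ p)) s

  ·ᵗ-congˡ : ∀ {a b} → a ≈ b → ∀ s → a ·ᵗ s ~ b ·ᵗ s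
  ·ᵗ-congˡ e [] = ~refl
  ·ᵗ-congˡ e (p ∷ s) = ~++ {s = _ ∷ []} (~coef _ (*-congʳ e)) (·ᵗ-congˡ e s)

  ·ᵗ-distribʳ : ∀ a b s → (a ·ᵗ s ++ b ·ᵗ s) ~ (a + b) ·ᵗ s
  ·ᵗ-distribʳ a b [] = ~refl
  ·ᵗ-distribʳ a b ((x , t) ∷ s) = ~trans
    (solve 4 (λ p q r u → (p ⊕ q) ⊕ (r ⊕ u) ⊜ (p ⊕ r) ⊕ (q ⊕ u)) ~refl ((a * x , t) ∷ []) (a ·ᵗ s) ((b * x , t) ∷ []) (b ·ᵗ s))
    (~++ {s = (a * x , t) ∷ (b * x , t) ∷ []} (~trans (~addc _ _ _) (~coef _ (sym (distribʳ x a b)))) (·ᵗ-distribʳ a b s))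

  0·ᵗs~[] : ∀ s → 0# ·ᵗ s ~ []
  0·ᵗs~[] [] = ~refl
  0·ᵗs~[] (p ∷ s) = ~++ {s = _ ∷ []} {t = 0# ·ᵗ s} (~trans (~coef _ (zeroˡ _)) (~zero _)) (0·ᵗs~[] s)

  1·ᵗs~s : ∀ s → 1# ·ᵗ s ~ s
  1·ᵗs~s [] = ~refl
  1·ᵗs~s (p ∷ s) = ~++ {s = _ ∷ []} {t = 1# ·ᵗ s} (~coef _ (*-identityˡ _)) (1·ᵗs~s s)

  s-s~[] : ∀ s → (s ++ (- 1#) ·ᵗ s) ~ []
  s-s~[] s = ~trans (~++ (~sym (1·ᵗs~s s)) ~refl)
    (~trans (·ᵗ-distribʳ 1# (- 1#) s) (~trans (·ᵗ-congˡ (-‿inverseʳ 1#) s) (0·ᵗs~[] s)))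

  ~⇒s-t~[] : ∀ {s t} → s ~ t → (s ++ (- 1#) ·ᵗ t) ~ []
  ~⇒s-t~[] {s} {t} p = ~trans (~++ p ~refl) (s-s~[] t)

  collect : {X : Set a} {Y : Set b} (xs : List X) (ys : List Y) (f : X → Y → Carrier) (T : Y → Tup) →
    ∑ᵗ xs (λ x → ∑ᵗ ys (λ y → (f x y , T y) ∷ [])) ~ ∑ᵗ ys (λ y → (∑ xs (λ x → f x y) , T y) ∷ [])
  collect [] ys f T = ~sym (zeros ys)
    where
    zeros : ∀ ys → ∑ᵗ ys (λ y → (0# , T y) ∷ []) ~ []
    zeros [] = ~refl
    zeros (y ∷ ys) = ~++ {s = (0# , T y) ∷ []} (~zero _) (zeros ys)
  collect (x ∷ xs) ys f T = ~trans (~++ {s = ∑ᵗ ys (λ y → (f x y , T y) ∷ [])} ~refl (collect xs ys f T))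
    (~trans (~sym (∑ᵗ.∑-∙ ys _ _)) (∑ᵗ.∑-cong ys (λ y → ~addc _ _ _)))

  module InducedFunctional {X : Set a} (f : (i : Fin k) → SetAlg.Carrier (W i) → X → Carrier)
      (f-+ : ∀ i u v x → f i (_+W_ (W i) u v) x ≈ f i u x + f i v x)
      (f-· : ∀ i b u x → f i (_·W_ (W i) b u) x ≈ b * f i u x) where

    Φ : Term → X → Carrier
    Φ s x = ∑ s (λ p → proj₁ p * ∏ (λ i → f i (proj₂ p i) x))

    rest : Tup → Fin k → X → Carrier
    rest t i x = ∏ (λ j → if j == i then 1# else f j (t j) x)

    Φ-++ : ∀ s t x → Φ (s ++ t) x ≈ Φ s x + Φ t x
    Φ-++ s t x = ∑-++ s t _

    Φ-∑ᵗ : {Y : Set b} (ys : List Y) (h : Y → Term) (x : X) → Φ (∑ᵗ ys h) x ≈ ∑ ys (λ y → Φ (h y) x)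
    Φ-∑ᵗ [] h x = ≈-refl
    Φ-∑ᵗ (y ∷ ys) h x = trans (Φ-++ (h y) _ x) (+-congˡ (Φ-∑ᵗ ys h x))

    Φ-·ᵗ : ∀ a s x → Φ (a ·ᵗ s) x ≈ a * Φ s x
    Φ-·ᵗ a s x = trans (≡⇒≈ (∑-map _ s _)) (trans (∑-cong s (λ p → *-assoc _ _ _)) (sym (∑-distribˡ s a _)))

    module _ {r} (_≈X_ : (X → Carrier) → (X → Carrier) → Set r)
        (≈X-pointwise : ∀ {g h} → (∀ x → g x ≈ h x) → g ≈X h)
        (≈X-sym : ∀ {g h} → g ≈X h → h ≈X g)
        (≈X-trans : ∀ {g h l} → g ≈X h → h ≈X l → g ≈X l)
        (≈X-+ : ∀ {g g' h h'} → g ≈X g' → h ≈X h' → (λ x → g x + h x) ≈X (λ x → g' x + h' x))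
        (≈X-slots : ∀ a t t' → (∀ i → _≈W_ (W i) (t i) (t' i)) → Φ ((a , t) ∷ []) ≈X Φ ((a , t') ∷ [])) where

      Φ-cong : ∀ {s s'} → s ~ s' → Φ s ≈X Φ s'
      Φ-cong ~refl = ≈X-pointwise (λ x → ≈-refl)
      Φ-cong (~sym p) = ≈X-sym (Φ-cong p)
      Φ-cong (~trans p q) = ≈X-trans (Φ-cong p) (Φ-cong q)
      Φ-cong (~++ {s} {s'} {t} {t'} p q) =
        ≈X-trans (≈X-pointwise (Φ-++ s t)) (≈X-trans (≈X-+ (Φ-cong p) (Φ-cong q)) (≈X-pointwise (λ x → sym (Φ-++ s' t' x))))
      Φ-cong (~swap s t) = ≈X-pointwise (λ x → trans (Φ-++ s t x) (trans (+-comm _ _) (sym (Φ-++ t s x))))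
      Φ-cong (~coef t e) = ≈X-pointwise (λ x → +-congʳ (*-congʳ e))
      Φ-cong (~slot a h) = ≈X-slots _ _ _ h
      Φ-cong (~zero t) = ≈X-pointwise (λ x → trans (+-identityʳ _) (zeroˡ _))
      Φ-cong (~addc a b t) = ≈X-pointwise (λ x → trans (+-congˡ (+-identityʳ _)) (trans (sym (distribʳ _ a b)) (sym (+-identityʳ _))))
      Φ-cong (~adds a t i u v) = ≈X-pointwise λ x → begin
        a * ∏ (λ j → f j (update t i (_+W_ (W i) u v) j) x) + 0#   ≈⟨ +-identityʳ _ ⟩
        a * ∏ (λ j → f j (update t i (_+W_ (W i) u v) j) x)        ≈⟨ *-congˡ (∏-update (λ j w → f j w x) t i _) ⟩
        a * (f i (_+W_ (W i) u v) x * rest t i x)                  ≈⟨ *-congˡ (trans (*-congʳ (f-+ i u v x)) (distribʳ _ _ _)) ⟩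
        a * (f i u x * rest t i x + f i v x * rest t i x)          ≈⟨ distribˡ _ _ _ ⟩
        a * (f i u x * rest t i x) + a * (f i v x * rest t i x)    ≈⟨ +-cong (*-congˡ (∏-update (λ j w → f j w x) t i u))
                                                                              (trans (+-identityʳ _) (*-congˡ (∏-update (λ j w → f j w x) t i v))) ⟨
        Φ ((a , update t i u) ∷ (a , update t i v) ∷ []) x         ∎
      Φ-cong (~scal a t i b u) = ≈X-pointwise λ x → +-congʳ (begin
        a * ∏ (λ j → f j (update t i (_·W_ (W i) b u) j) x)        ≈⟨ *-congˡ (∏-update (λ j w → f j w x) t i _) ⟩
        a * (f i (_·W_ (W i) b u) x * rest t i x)                  ≈⟨ *-congˡ (*-congʳ (f-· i b u x)) ⟩
        a * ((b * f i u x) * rest t i x)                           ≈⟨ trans (*-assoc _ _ _) (*-congˡ (sym (*-assoc _ _ _))) ⟨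
        (a * b) * (f i u x * rest t i x)                           ≈⟨ *-congˡ (∏-update (λ j w → f j w x) t i u) ⟨
        (a * b) * ∏ (λ j → f j (update t i u j) x)                 ∎)

-- SetAlg carries no laws, so reflexivity in each factor and a way of writing 0 as 0 · z are
-- taken as hypotheses.
module Expansion {c ℓ} (K : Field c ℓ) where
  open FieldFacts K
  open SetAlg using () renaming (Carrier to CW; _≈_ to _≈W_; _·_ to _·W_; 0v to 0W; ΣV to ΣW)

  module _ {k} (W : Fin k → SetAlg K) (≈W-refl : ∀ i x → _≈W_ (W i) x x) where
    open TensorFacts K W

    ≡⇒≈W : ∀ i {x y} → x ≡ y → _≈W_ (W i) x y
    ≡⇒≈W i refl = ≈W-refl i _

    update-congˡ : (t : Tup) (i : Fin k) {x y : CW (W i)} → _≈W_ (W i) x y → ∀ j → _≈W_ (W j) (update t i x j) (update t i y j)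
    update-congˡ t i x≈y j with j ≟F i
    ... | yes refl = x≈y
    ... | no _ = ≈W-refl j (t j)

    update-slot : (t : Tup) (i : Fin k) {y : CW (W i)} → _≈W_ (W i) (t i) y → ∀ j → _≈W_ (W j) (t j) (update t i y j)
    update-slot t i ti≈y j with j ≟F i
    ... | yes refl = ti≈y
    ... | no _ = ≈W-refl j (t j)

    expand-slot : (zero-scaled : ∀ i → ∃ λ z → _≈W_ (W i) (0W (W i)) (_·W_ (W i) 0# z))
      (i : Fin k) {X : Set} (L : List X) (cf : X → Carrier) (v : X → CW (W i)) (a : Carrier) (t : Tup) →
      _≈W_ (W i) (t i) (ΣW (W i) L (λ x → _·W_ (W i) (cf x) (v x))) →
      ((a , t) ∷ []) ~ ∑ᵗ L (λ x → (a * cf x , update t i (v x)) ∷ [])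
    expand-slot zero-scaled i L cf v a t h = ~trans (~slot a (update-slot t i h)) (go L)
      where
      go : ∀ L → ((a , update t i (ΣW (W i) L (λ x → _·W_ (W i) (cf x) (v x)))) ∷ []) ~ ∑ᵗ L (λ x → (a * cf x , update t i (v x)) ∷ [])
      go [] = let z , 0≈0·z = zero-scaled i in
        ~trans (~slot a (update-congˡ t i 0≈0·z)) (~trans (~scal a t i 0# z) (~trans (~coef _ (zeroʳ a)) (~zero _)))
      go (x ∷ L) = ~trans (~adds a t i _ _) (~++ {s = (a , update t i (_·W_ (W i) (cf x) (v x))) ∷ []} (~scal a t i (cf x) (v x)) (go L))

  module Prepend {k} (W : Fin (suc k) → SetAlg K) (≈W-refl : ∀ i x → _≈W_ (W i) x x) (u : CW (W zero)) where
    module Full = TensorFacts K W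
    module Tail = TensorFacts K (W ∘ suc)

    prepend : Tail.Term → Full.Term
    prepend = map (λ p → (proj₁ p , cons u (proj₂ p)))

    prepend-++ : ∀ s t → prepend (s ++ t) ≡ prepend s ++ prepend t
    prepend-++ s t = ListP.map-++ _ s t

    prepend-∑ᵗ : {Y : Set} (ys : List Y) (f : Y → Tail.Term) → prepend (Tail.∑ᵗ ys f) ≡ Full.∑ᵗ ys (prepend ∘ f)
    prepend-∑ᵗ [] f = refl
    prepend-∑ᵗ (y ∷ ys) f = ≡.trans (prepend-++ (f y) _) (≡.cong (prepend (f y) ++_) (prepend-∑ᵗ ys f))

    cons-update : (t : Tail.Tup) (i : Fin k) (w : CW (W (suc i))) →
      ∀ j → cons {A = CW ∘ W} u (update t i w) j ≡ update (cons {A = CW ∘ W} u t) (suc i) w j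
    cons-update t i w zero = refl
    cons-update t i w (suc j) = by-cases (j ≟F i)
      where
      by-cases : Dec (j ≡ i) → update t i w j ≡ update (cons {A = CW ∘ W} u t) (suc i) w (suc j)
      by-cases (yes refl) = ≡.trans (update-same t j w) (≡.sym (update-same {F = CW ∘ W} (cons u t) (suc j) w))
      by-cases (no j≢i) = ≡.trans (update-other t i w j j≢i) (≡.sym (update-other {F = CW ∘ W} (cons u t) (suc i) w (suc j) (j≢i ∘ suc-injective)))

    prepend-cong : ∀ {s s'} → s Tail.~ s' → prepend s Full.~ prepend s'
    prepend-cong Tail.~refl = Full.~refl
    prepend-cong (Tail.~sym p) = Full.~sym (prepend-cong p)
    prepend-cong (Tail.~trans p q) = Full.~trans (prepend-cong p) (prepend-cong q)
    prepend-cong (Tail.~++ {s} {s'} {t} {t'} p q) =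
      Full.~trans (Full.≡⇒~ (prepend-++ s t)) (Full.~trans (Full.~++ (prepend-cong p) (prepend-cong q)) (Full.≡⇒~ (≡.sym (prepend-++ s' t'))))
    prepend-cong (Tail.~swap s t) =
      Full.~trans (Full.≡⇒~ (prepend-++ s t)) (Full.~trans (Full.~swap (prepend s) (prepend t)) (Full.≡⇒~ (≡.sym (prepend-++ t s))))
    prepend-cong (Tail.~coef t e) = Full.~coef _ e
    prepend-cong (Tail.~slot a h) = Full.~slot a (λ { zero → ≈W-refl zero u ; (suc i) → h i })
    prepend-cong (Tail.~zero t) = Full.~zero _
    prepend-cong (Tail.~addc a b t) = Full.~addc a b _
    prepend-cong (Tail.~adds a t i x y) =
      Full.~trans (Full.~slot a (≡⇒≈W W ≈W-refl _ ∘ cons-update t i _))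
        (Full.~trans (Full.~adds a (cons u t) (suc i) x y)
          (Full.~++ {s = (a , update (cons u t) (suc i) x) ∷ []}
            (Full.~slot a (≡⇒≈W W ≈W-refl _ ∘ ≡.sym ∘ cons-update t i x)) (Full.~slot a (≡⇒≈W W ≈W-refl _ ∘ ≡.sym ∘ cons-update t i y))))
    prepend-cong (Tail.~scal a t i b x) =
      Full.~trans (Full.~slot a (≡⇒≈W W ≈W-refl _ ∘ cons-update t i _))
        (Full.~trans (Full.~scal a (cons u t) (suc i) b x) (Full.~slot _ (≡⇒≈W W ≈W-refl _ ∘ ≡.sym ∘ cons-update t i x)))

  expand : ∀ {k} (W : Fin k → SetAlg K) (≈W-refl : ∀ i x → _≈W_ (W i) x x)
    (zero-scaled : ∀ i → ∃ λ z → _≈W_ (W i) (0W (W i)) (_·W_ (W i) 0# z))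
    {X : Fin k → Set} (L : (i : Fin k) → List (X i)) (cf : (i : Fin k) → X i → Carrier) (v : (i : Fin k) → X i → CW (W i))
    (a : Carrier) (t : TensorFacts.Tup K W) →
    (∀ i → _≈W_ (W i) (t i) (ΣW (W i) (L i) (λ x → _·W_ (W i) (cf i x) (v i x)))) →
    TensorFacts._~_ K W ((a , t) ∷ []) (TensorFacts.∑ᵗ K W (tuples L) (λ τ → (a * ∏ (λ i → cf i (τ i)) , (λ i → v i (τ i))) ∷ []))
  expand {zero} W ≈W-refl zero-scaled L cf v a t h = ~trans (~coef t (sym (*-identityʳ a))) (~slot _ (λ ()))
    where open TensorFacts K W
  expand {suc k} W ≈W-refl zero-scaled {X} L cf v a t h =
    ~trans (expand-slot W ≈W-refl zero-scaled zero (L zero) (cf zero) (v zero) a t (h zero))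
      (~trans (∑ᵗ.∑-cong (L zero) expand-tail)
        (~sym (~trans (∑ᵗ.∑-concatMap (λ x → map (cons x) T) (L zero) G) (∑ᵗ.∑-cong (L zero) (λ x → ≡⇒~ (∑ᵗ.∑-map (cons x) T G))))))
    where
    open TensorFacts K W
    T : List ((i : Fin k) → X (suc i))
    T = tuples (L ∘ suc)
    G : ((i : Fin (suc k)) → X i) → Term
    G τ = (a * ∏ (λ i → cf i (τ i)) , (λ i → v i (τ i))) ∷ []
    expand-tail : ∀ x → ((a * cf zero x , update t zero (v zero x)) ∷ []) ~ ∑ᵗ T (G ∘ cons x)
    expand-tail x = ~trans (~slot _ (λ { zero → ≈W-refl _ _ ; (suc j) → ≈W-refl _ _ }))
      (~trans (prepend-cong (expand (W ∘ suc) (≈W-refl ∘ suc) (zero-scaled ∘ suc) (L ∘ suc) (cf ∘ suc) (v ∘ suc) (a * cf zero x) (t ∘ suc) (h ∘ suc)))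
        (~trans (≡⇒~ (prepend-∑ᵗ T _))
          (∑ᵗ.∑-cong T (λ τ → ~trans (~coef _ (*-assoc _ _ _)) (~slot _ (λ { zero → ≈W-refl _ _ ; (suc i) → ≈W-refl _ _ }))))))
      where open Prepend W ≈W-refl (v zero x)

  expand-term : ∀ {k} (W : Fin k → SetAlg K) (≈W-refl : ∀ i x → _≈W_ (W i) x x)
    (zero-scaled : ∀ i → ∃ λ z → _≈W_ (W i) (0W (W i)) (_·W_ (W i) 0# z))
    {X : Fin k → Set} (L : (i : Fin k) → List (X i)) (ev : (i : Fin k) → CW (W i) → X i → Carrier) (v : (i : Fin k) → X i → CW (W i)) →
    (∀ i w → _≈W_ (W i) w (ΣW (W i) (L i) (λ x → _·W_ (W i) (ev i w x) (v i x)))) →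
    ∀ s → TensorFacts._~_ K W s
      (TensorFacts.∑ᵗ K W (tuples L) (λ τ → (∑ s (λ p → proj₁ p * ∏ (λ i → ev i (proj₂ p i) (τ i))) , (λ i → v i (τ i))) ∷ []))
  expand-term W ≈W-refl zero-scaled L ev v h s =
    ~trans (≡⇒~ (singletons s))
      (~trans (∑ᵗ.∑-cong s (λ p → expand W ≈W-refl zero-scaled L (λ i → ev i (proj₂ p i)) v (proj₁ p) (proj₂ p) (λ i → h i (proj₂ p i))))
        (collect s (tuples L) (λ p τ → proj₁ p * ∏ (λ i → ev i (proj₂ p i) (τ i))) (λ τ i → v i (τ i))))
    where open TensorFacts K W

-- The power set basis and symmetric powers of ⟨P[1]⟩

module PowerSetBasis {c ℓ} (K : Field c ℓ) {n : ℕ} where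
  open FieldFacts K

  δ : Vec Bool n → Vec Bool n → Carrier
  δ x z = [ eqᵇ _≟V_ x z ]

  ∑-δ : ∀ x (f : Vec Bool n → Carrier) → ∑ (allSubsets n) (λ a → δ x a * f a) ≈ f x
  ∑-δ x f = ∑-select (allSubsets n) (eqᵇ _≟V_ x) f (f x)
    (≡.trans (count-cong _ _ (allSubsets n) (All.universal (λ a → eqᵇ-sym _≟V_ x a) _)) (count-allSubsets n x))
    (λ a e → ≡⇒≈ (≡.cong f (≡.sym (eqᵇ⇒≡ _≟V_ e))))

  private
    if≈δ* : ∀ b (X : Carrier) → (if b then X else 0#) ≈ X * [ b ]
    if≈δ* true X = sym (*-identityʳ X)
    if≈δ* false X = sym (zeroʳ X)

  δ-bilinear : (op : Vec Bool n → Vec Bool n → Vec Bool n) (x y z : Vec Bool n) →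
    ∑ (allSubsets n) (λ a → ∑ (allSubsets n) (λ a' → if eqᵇ _≟V_ (op a a') z then δ x a * δ y a' else 0#)) ≈ δ (op x y) z
  δ-bilinear op x y z = begin
    ∑ S (λ a → ∑ S (λ a' → if eqᵇ _≟V_ (op a a') z then δ x a * δ y a' else 0#)) ≈⟨ ∑-cong S (λ a → ∑-cong S (λ a' → trans (if≈δ* _ _) (*-assoc _ _ _))) ⟩
    ∑ S (λ a → ∑ S (λ a' → δ x a * (δ y a' * δ (op a a') z)))                     ≈⟨ ∑-cong S (λ a → ∑-distribˡ S _ _) ⟨
    ∑ S (λ a → δ x a * ∑ S (λ a' → δ y a' * δ (op a a') z))                       ≈⟨ ∑-cong S (λ a → *-congˡ (∑-δ y (λ a' → δ (op a a') z))) ⟩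
    ∑ S (λ a → δ x a * δ (op a y) z)                                              ≈⟨ ∑-δ x (λ a → δ (op a y) z) ⟩
    δ (op x y) z                                                                  ∎
    where
    S : List (Vec Bool n)
    S = allSubsets n

  δ-∪ : ∀ x y z → SetAlg._∪_ (⟨P⟩ K n) (δ x) (δ y) z ≈ δ (x Sub.∪ y) z
  δ-∪ = δ-bilinear Sub._∪_

  δ-∩ : ∀ x y z → SetAlg._∩_ (⟨P⟩ K n) (δ x) (δ y) z ≈ δ (x Sub.∩ y) z
  δ-∩ = δ-bilinear Sub._∩_

  δ-∁ : ∀ x z → SetAlg.∁ (⟨P⟩ K n) (δ x) z ≈ δ (Sub.∁ x) z
  δ-∁ x z = trans (∑-cong (allSubsets n) (λ a → if≈δ* _ _)) (∑-δ x (λ a → δ (Sub.∁ a) z))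

  ΣV-apply : {X : Set} (xs : List X) (h : X → Vec Bool n → Carrier) (A : Vec Bool n) → SetAlg.ΣV (⟨P⟩ K n) xs h A ≡ ∑ xs (λ x → h x A)
  ΣV-apply [] h A = refl
  ΣV-apply (x ∷ xs) h A = ≡.cong (h x A +_) (ΣV-apply xs h A)

  δ-permute : (g : Fin n → Fin n) → Injective _≡_ _≡_ g → ∀ X A → δ (permuteVec X g) (permuteVec A g) ≡ δ X A
  δ-permute g g-inj X A = ≡.cong [_] (eqᵇ-permuteVec g g-inj X A)

module SymmetricPower {c ℓ} (K : Field c ℓ) (m : ℕ) where
  open FieldFacts K
  open PowerSetBasis K {1}
  module ⊗ = TensorFacts K {m} (λ _ → ⟨P[1]⟩ K)
  open SetAlg (Symᵐ⟨P[1]⟩ K m) using () renaming (_≈_ to _≈S_)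

  δ₁ : Bool → Vec Bool 1 → Carrier
  δ₁ b = δ (b ∷ [])

  pure : (Fin m → Bool) → ⊗.Term
  pure β = (1# , δ₁ ∘ β) ∷ []

  open ⊗.InducedFunctional {X = Fin m → Bool} (λ j u β → u (β j ∷ [])) (λ j u v β → ≈-refl) (λ j b u β → ≈-refl) public
    renaming (Φ to coeff; Φ-++ to coeff-++; Φ-·ᵗ to coeff-·ᵗ)

  coeff-cong : ∀ {s s'} → s ⊗.~ s' → ∀ β → coeff s β ≈ coeff s' β
  coeff-cong = Φ-cong (λ g h → ∀ β → g β ≈ h β) (λ h → h) (λ h β → sym (h β)) (λ h h' β → trans (h β) (h' β))
    (λ h h' β → +-cong (h β) (h' β)) (λ a t t' h β → +-congʳ (*-congˡ (∏-cong (λ j → lower (h j) (β j ∷ [])))))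

  coeff-congʳ : ∀ s {β β'} → (∀ j → β j ≡ β' j) → coeff s β ≈ coeff s β'
  coeff-congʳ s h = ∑-cong s (λ p → *-congˡ (∏-cong (λ j → ≡⇒≈ (≡.cong (λ b → proj₂ p j (b ∷ [])) (h j)))))

  coeff-pure : ∀ β' β → coeff (pure β') β ≈ [ eqᶠ _≟B_ β' β ]
  coeff-pure β' β = trans (+-identityʳ _) (trans (*-identityˡ _)
    (trans (∏-cong (λ j → ≡⇒≈ (≡.cong [_] (eqᵇ-∷ (β' j) (β j) [] [])))) (∏-indicator (λ j → eqᵇ _≟B_ (β' j) (β j)))))

  coeff-act : ∀ σ → (σ-inj : Injective _≡_ _≡_ σ) → ∀ w β → coeff (actT K σ w) β ≈ coeff w (β ∘ inverse σ)
  coeff-act σ σ-inj w β = trans (≡⇒≈ (∑-map _ w _)) (∑-cong w (λ p → *-congˡ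
    (sym (trans (∏-permute _ (toPermutation σ σ-inj))
      (∏-cong (λ j → ≡⇒≈ (≡.cong (λ i → proj₂ p (σ j) (β i ∷ [])) (inverseˡ σ σ-inj j))))))))

  ~⇒≈S : ∀ {s s'} → s ⊗.~ s' → s ≈S s'
  ~⇒≈S {s} {s'} p = [] , ⊗.~⇒s-t~[] {s} {s'} p

  ≈S-refl : ∀ s → s ≈S s
  ≈S-refl s = ~⇒≈S {s} ⊗.~refl

  pure-cong : ∀ {β β'} → (∀ j → β j ≡ β' j) → pure β ≈S pure β'
  pure-cong {β} β≗β' = ~⇒≈S {pure β} (⊗.~slot 1# (λ j → lift (λ z → ≡⇒≈ (≡.cong (λ b → δ₁ b z) (β≗β' j)))))

  pure-permute : ∀ β β' j → (∀ i → β' (lookup (Sym m) j i) ≡ β i) → pure β ≈S pure β'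
  pure-permute β β' j h = ((j , pure β') ∷ []) ,
    ⊗.~trans (⊗.~++ {s = pure β} (⊗.~slot 1# (λ i → lift (λ z → ≡⇒≈ (≡.cong (λ b → δ₁ b z) (≡.sym (h i)))))) ⊗.~refl)
             (⊗.≡⇒~ (≡.sym (ListP.++-identityʳ _)))

  δ₁-basis : ∀ u → SetAlg._≈_ (⟨P[1]⟩ K) u (SetAlg.ΣV (⟨P[1]⟩ K) bools (λ b → SetAlg._·_ (⟨P[1]⟩ K) (u (b ∷ [])) (δ₁ b)))
  δ₁-basis u = lift λ
    { (false ∷ []) → sym (trans (+-congˡ (trans (+-identityʳ _) (zeroʳ _))) (trans (+-identityʳ _) (*-identityʳ _)))
    ; (true ∷ []) → sym (trans (+-cong (zeroʳ _) (trans (+-identityʳ _) (*-identityʳ _))) (+-identityˡ _)) }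

  expand-pure : ∀ s → s ≈S SetAlg.ΣV (Symᵐ⟨P[1]⟩ K m) (tuples (λ _ → bools)) (λ β → SetAlg._·_ (Symᵐ⟨P[1]⟩ K m) (coeff s β) (pure β))
  expand-pure s = ~⇒≈S (⊗.~trans (Expansion.expand-term K (λ _ → ⟨P[1]⟩ K) (λ _ _ → lift (λ _ → ≈-refl)) (λ _ → (λ _ → 0#) , lift (λ _ → sym (zeroˡ _)))
      (λ _ → bools) (λ j u b → u (b ∷ [])) (λ j → δ₁) (λ j → δ₁-basis) s)
    (⊗.∑ᵗ.∑-cong (tuples (λ _ → bools)) (λ β → ⊗.~coef (δ₁ ∘ β) (sym (*-identityʳ (coeff s β))))))

  coeff-ΣV : {X : Set} (xs : List X) (h : X → ⊗.Term) (γ : Fin m → Bool) → coeff (SetAlg.ΣV (⟨P[1]⟩^⊗ K m) xs h) γ ≈ ∑ xs (λ x → coeff (h x) γ)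
  coeff-ΣV [] h γ = ≈-refl
  coeff-ΣV (x ∷ xs) h γ = trans (coeff-++ (h x) _ γ) (+-congˡ (coeff-ΣV xs h γ))

  #Sym : Carrier
  #Sym = ι (length (Sym m))

  module _ (_⊙_ : SetAlg.Carrier (⟨P[1]⟩ K) → SetAlg.Carrier (⟨P[1]⟩ K) → SetAlg.Carrier (⟨P[1]⟩ K)) (_•_ : Bool → Bool → Bool)
           (δ₁-⊙ : ∀ b b' c → (δ₁ b ⊙ δ₁ b') (c ∷ []) ≈ [ eqᵇ _≟B_ (b • b') c ]) where

    coeff-average : ∀ β β' γ →
      coeff (SetAlg._·_ (⟨P[1]⟩^⊗ K m) (#Sym ⁻¹) (SetAlg.ΣV (⟨P[1]⟩^⊗ K m) (Sym m) (λ σ → ⊗.bilinT (λ _ → _⊙_) (pure β) (actT K σ (pure β'))))) γ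
        ≈ #Sym ⁻¹ * ∑ (Sym m) (λ σ → [ eqᶠ _≟B_ (λ j → β j • β' (σ j)) γ ])
    coeff-average β β' γ = trans (coeff-·ᵗ (#Sym ⁻¹) (SetAlg.ΣV (⟨P[1]⟩^⊗ K m) (Sym m) (λ σ → ⊗.bilinT (λ _ → _⊙_) (pure β) (actT K σ (pure β')))) γ) (*-congˡ (trans (coeff-ΣV (Sym m) _ γ) (∑-cong (Sym m) coeff-pair)))
      where
      coeff-pair : ∀ σ → coeff (⊗.bilinT (λ _ → _⊙_) (pure β) (actT K σ (pure β'))) γ ≈ [ eqᶠ _≟B_ (λ j → β j • β' (σ j)) γ ]
      coeff-pair σ = trans (+-identityʳ _) (trans (*-congʳ (*-identityˡ 1#)) (trans (*-identityˡ _)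
        (trans (∏-cong (λ j → δ₁-⊙ (β j) (β' (σ j)) (γ j))) (∏-indicator (λ j → eqᵇ _≟B_ (β j • β' (σ j)) (γ j))))))

  coeff-∪ : ∀ β β' γ → coeff (SetAlg._∪_ (Symᵐ⟨P[1]⟩ K m) (pure β) (pure β')) γ ≈ #Sym ⁻¹ * ∑ (Sym m) (λ σ → [ eqᶠ _≟B_ (λ j → β j ∨ β' (σ j)) γ ])
  coeff-∪ = coeff-average (SetAlg._∪_ (⟨P[1]⟩ K)) _∨_
    (λ b b' c → trans (δ-∪ (b ∷ []) (b' ∷ []) (c ∷ [])) (≡⇒≈ (≡.cong [_] (eqᵇ-∷ (b ∨ b') c [] []))))

  coeff-∩ : ∀ β β' γ → coeff (SetAlg._∩_ (Symᵐ⟨P[1]⟩ K m) (pure β) (pure β')) γ ≈ #Sym ⁻¹ * ∑ (Sym m) (λ σ → [ eqᶠ _≟B_ (λ j → β j ∧ β' (σ j)) γ ])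
  coeff-∩ = coeff-average (SetAlg._∩_ (⟨P[1]⟩ K)) _∧_
    (λ b b' c → trans (δ-∩ (b ∷ []) (b' ∷ []) (c ∷ [])) (≡⇒≈ (≡.cong [_] (eqᵇ-∷ (b ∧ b') c [] []))))

  coeff-∁ : ∀ β γ → coeff (SetAlg.∁ (Symᵐ⟨P[1]⟩ K m) (pure β)) γ ≈ [ eqᶠ _≟B_ (not ∘ β) γ ]
  coeff-∁ β γ = trans (+-identityʳ _) (trans (*-identityˡ _)
    (trans (∏-cong (λ j → trans (δ-∁ (β j ∷ []) (γ j ∷ [])) (≡⇒≈ (≡.cong [_] (eqᵇ-∷ (not (β j)) (γ j) [] [])))))
           (∏-indicator (λ j → eqᵇ _≟B_ (not (β j)) (γ j)))))

  Relator : Set c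
  Relator = Fin (length (Sym m)) × ⊗.Term

  coeff-relation : ∀ (ps : List Relator) β →
    coeff (SetAlg.ΣV (⟨P[1]⟩^⊗ K m) ps (λ p → SetAlg._-_ (⟨P[1]⟩^⊗ K m) (actT K (lookup (Sym m) (proj₁ p)) (proj₂ p)) (proj₂ p))) β
      ≈ ∑ ps (λ p → coeff (actT K (lookup (Sym m) (proj₁ p)) (proj₂ p)) β ⊖ coeff (proj₂ p) β)
  coeff-relation [] β = ≈-refl
  coeff-relation ((σ , w) ∷ ps) β =
    trans (coeff-++ (actT K (lookup (Sym m) σ) w ++ (- 1#) ⊗.·ᵗ w) _ β)
      (+-cong (trans (coeff-++ (actT K (lookup (Sym m) σ) w) _ β) (+-congˡ (coeff-·ᵗ (- 1#) w β))) (coeff-relation ps β))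

  coeff-≈S : ∀ {s s'} → s ≈S s' → ∃ λ (ps : List Relator) →
    ∀ β → coeff s β ⊖ coeff s' β ≈ ∑ ps (λ p → coeff (actT K (lookup (Sym m) (proj₁ p)) (proj₂ p)) β ⊖ coeff (proj₂ p) β)
  coeff-≈S {s} {s'} (ps , s-s'~) = ps , λ β →
    trans (sym (trans (coeff-++ s ((- 1#) ⊗.·ᵗ s') β) (+-congˡ (coeff-·ᵗ (- 1#) s' β))))
          (trans (coeff-cong s-s'~ β) (coeff-relation ps β))

-- Coinvariants of ⟨P(x)⟩ and the tensor product of symmetric powers

module _ {n k : ℕ} (blk : Fin n → Fin k) where
  open Blocks blk

  onBlock : (i : Fin k) → (Fin (size i) → Fin (size i)) → BlockPerm
  onBlock i π = update {F = λ i → Fin (size i) → Fin (size i)} (λ _ → id) i π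

  onBlock-injective : ∀ i π → Injective _≡_ _≡_ π → ∀ j → Injective _≡_ _≡_ (onBlock i π j)
  onBlock-injective i π π-inj j = by-cases (j ≟F i)
    where
    by-cases : Dec (j ≡ i) → Injective _≡_ _≡_ (onBlock i π j)
    by-cases (yes refl) = ≡.subst (Injective _≡_ _≡_) (≡.sym (update-same {F = λ i → Fin (size i) → Fin (size i)} _ j π)) π-inj
    by-cases (no j≢i) = ≡.subst (Injective _≡_ _≡_) (≡.sym (update-other {F = λ i → Fin (size i) → Fin (size i)} _ i π j j≢i)) id

  BlockSubset : Set
  BlockSubset = PerBlock Bool

  blockSubsets : List BlockSubset
  blockSubsets = tuples (λ i → tuples (λ _ → bools))

  eqᴮ : BlockSubset → BlockSubset → Bool
  eqᴮ B B' = andF (λ i → eqᶠ _≟B_ (B i) (B' i))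

  eqᴮ⇒≗ : ∀ {B B'} → eqᴮ B B' ≡ true → ∀ i j → B i j ≡ B' i j
  eqᴮ⇒≗ e i = eqᶠ⇒≗ _≟B_ (andF⇒ _ e i)

  ≗⇒eqᴮ : ∀ {B B'} → (∀ i j → B i j ≡ B' i j) → eqᴮ B B' ≡ true
  ≗⇒eqᴮ h = ⇒andF _ (λ i → ≗⇒eqᶠ _≟B_ (h i))

  eqᴮ-sym : ∀ B B' → eqᴮ B B' ≡ eqᴮ B' B
  eqᴮ-sym B B' = andF-cong _ _ (λ i → eqᶠ-sym _≟B_ (B i) (B' i))

  count-blockSubsets : ∀ B → count (λ B' → eqᴮ B' B) blockSubsets ≡ 1
  count-blockSubsets B = ≡.trans (count-tuples (λ i → tuples (λ _ → bools)) (λ i β → eqᶠ _≟B_ β (B i)))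
    (prodF-1 _ (λ i → ≡.trans (count-tuples (λ _ → bools) (λ j b → eqᵇ _≟B_ b (B i j))) (prodF-1 _ (λ j → count-bools (B i j)))))

  count-blockSubsets' : ∀ B → count (eqᴮ B) blockSubsets ≡ 1
  count-blockSubsets' B = ≡.trans (count-cong _ _ blockSubsets (All.universal (eqᴮ-sym B) _)) (count-blockSubsets B)

  toSubset : BlockSubset → Vec Bool n
  toSubset B = Vec.tabulate (assemble B)

  fromSubset : Vec Bool n → BlockSubset
  fromSubset A = restrict (Vec.lookup A)

  toSubset-cong : ∀ {B B'} → (∀ i j → B i j ≡ B' i j) → toSubset B ≡ toSubset B'
  toSubset-cong h = VecP.tabulate-cong (λ x → h (blk x) (rank x))

  toSubset-fromSubset : ∀ A → toSubset (fromSubset A) ≡ A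
  toSubset-fromSubset A = ≡.trans (VecP.tabulate-cong (assemble-restrict (Vec.lookup A))) (VecP.tabulate∘lookup A)

  fromSubset-toSubset : ∀ B i j → fromSubset (toSubset B) i j ≡ B i j
  fromSubset-toSubset B i j = ≡.trans (VecP.lookup∘tabulate (assemble B) (elem i j)) (restrict-assemble B i j)

  eqᵇ-toSubset : ∀ B A → eqᵇ _≟V_ (toSubset B) A ≡ eqᴮ B (fromSubset A)
  eqᵇ-toSubset B A = true-iff⇒≡
    (λ e → ≗⇒eqᴮ (λ i j → ≡.trans (≡.sym (fromSubset-toSubset B i j)) (≡.cong (λ A' → fromSubset A' i j) (eqᵇ⇒≡ _≟V_ e))))
    (λ e → ≡⇒eqᵇ _≟V_ (≡.trans (toSubset-cong (eqᴮ⇒≗ e)) (toSubset-fromSubset A)))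

  eqᵇ-toSubset-toSubset : ∀ B B' → eqᵇ _≟V_ (toSubset B) (toSubset B') ≡ eqᴮ B B'
  eqᵇ-toSubset-toSubset B B' = ≡.trans (eqᵇ-toSubset B (toSubset B')) (andF-cong _ _ (λ i → andF-cong _ _ (λ j →
    ≡.cong (eqᵇ _≟B_ (B i j)) (fromSubset-toSubset B' i j))))

  module YoungAction (g : Fin n → Fin n) (young : IsYoung g) where

    ρ : BlockPerm
    ρ = restrictPerm g

    ρ-injective : ∀ i → Injective _≡_ _≡_ (ρ i)
    ρ-injective = restrictPerm-injective g young

    permuteᴮ : BlockSubset → BlockSubset
    permuteᴮ B i j = B i (ρ i j)

    toSubset-permuteᴮ : ∀ B → permuteVec (toSubset B) g ≡ toSubset (permuteᴮ B)
    toSubset-permuteᴮ B = VecP.tabulate-cong (λ x → ≡.trans (VecP.lookup∘tabulate (assemble B) (g x)) (assemble-young B g young x))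

    module _ {a r} (M : CommutativeMonoid a r) where
      open CommutativeMonoid M using (_≈_; trans)
      open ListSum M

      ∑-permuteᴮ : (F G : BlockSubset → CommutativeMonoid.Carrier M) → (∀ {B B'} → (∀ i j → B i j ≡ B' i j) → G B ≈ G B') →
        (∀ B → F B ≈ G (permuteᴮ B)) → ∑ blockSubsets F ≈ ∑ blockSubsets G
      ∑-permuteᴮ F G G-cong F≈G∘permute = ∑-reindex blockSubsets blockSubsets R F G
        (All.universal (λ B → count-blockSubsets' (permuteᴮ B)) _)
        (All.universal (λ B' → ≡.trans (count-cong (λ B → R B B') (λ B → eqᴮ B (unpermute B')) blockSubsets (All.universal (R-unpermute B') _))
                                       (count-blockSubsets (unpermute B'))) _)
        (All.universal (λ B → All.universal (λ B' e → trans (F≈G∘permute B) (G-cong (eqᴮ⇒≗ e))) _) _)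
        where
        R : BlockSubset → BlockSubset → Bool
        R B B' = eqᴮ (permuteᴮ B) B'
        unpermute : BlockSubset → BlockSubset
        unpermute B i j = B i (inverse (ρ i) j)
        R-unpermute : ∀ B' B → R B B' ≡ eqᴮ B (unpermute B')
        R-unpermute B' B = true-iff⇒≡
          (λ e → ≗⇒eqᴮ (λ i j → ≡.trans (≡.cong (B i) (≡.sym (inverseʳ (ρ i) (ρ-injective i) j))) (eqᴮ⇒≗ e i (inverse (ρ i) j))))
          (λ e → ≗⇒eqᴮ (λ i j → ≡.trans (eqᴮ⇒≗ e i (ρ i j)) (≡.cong (B' i) (inverseˡ (ρ i) (ρ-injective i) j))))

module Isomorphism {c ℓ} (K : Field c ℓ) {n k : ℕ} (blk : Fin n → Fin k) where
  open FieldFacts K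
  open Blocks blk
  module S (i : Fin k) = SymmetricPower K (size i)

  W : Fin k → SetAlg K
  W i = Symᵐ⟨P[1]⟩ K (size i)

  module ⊗ = TensorFacts K W
  open SetAlg (⟨P⟩/Young K blk) using () renaming (_≈_ to _≈P_)

  pureᴮ : BlockSubset blk → ⊗.Tup
  pureᴮ B i = S.pure i (B i)

  φ : (Vec Bool n → Carrier) → ⊗.Term
  φ f = ⊗.∑ᵗ (blockSubsets blk) (λ B → (f (toSubset blk B) , pureᴮ B) ∷ [])

  Relator : Set c
  Relator = Fin (length (Young blk)) × (Vec Bool n → Carrier)

  relator : Relator → Vec Bool n → Carrier
  relator p A = actP K (lookup (Young blk) (proj₁ p)) (proj₂ p) A ⊖ proj₂ p A

  private
    ΣV-relators : ∀ ps A →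
      SetAlg.ΣV (⟨P⟩ K n) ps (λ p → SetAlg._-_ (⟨P⟩ K n) (actP K (lookup (Young blk) (proj₁ p)) (proj₂ p)) (proj₂ p)) A ≡ ∑ ps (λ p → relator p A)
    ΣV-relators [] A = refl
    ΣV-relators (p ∷ ps) A = ≡.cong (relator p A +_) (ΣV-relators ps A)

  ≈P-intro : ∀ {u v} ps → (∀ A → u A ⊖ v A ≈ ∑ ps (λ p → relator p A)) → u ≈P v
  ≈P-intro ps h = ps , lift (λ A → trans (h A) (≡⇒≈ (≡.sym (ΣV-relators ps A))))

  ≈P-elim : ∀ {u v} → u ≈P v → ∃ λ ps → ∀ A → u A ⊖ v A ≈ ∑ ps (λ p → relator p A)
  ≈P-elim (ps , lift h) = ps , (λ A → trans (h A) (≡⇒≈ (ΣV-relators ps A)))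

  ≈P-pointwise : ∀ {u v} → (∀ A → u A ≈ v A) → u ≈P v
  ≈P-pointwise h = ≈P-intro [] (λ A → trans (⊖-cong (h A) ≈-refl) (x⊖x≈0 _))

  ≈P-refl : ∀ {u} → u ≈P u
  ≈P-refl = ≈P-pointwise (λ A → ≈-refl)

  ≈P-trans : ∀ {u v w} → u ≈P v → v ≈P w → u ≈P w
  ≈P-trans u≈v v≈w with ≈P-elim u≈v | ≈P-elim v≈w
  ... | ps , h | qs , h' = ≈P-intro (ps ++ qs) (λ A → trans (sym (⊖-+-⊖ _ _ _)) (trans (+-cong (h A) (h' A)) (sym (∑-++ ps qs _))))

  ≈P-sym : ∀ {u v} → u ≈P v → v ≈P u
  ≈P-sym u≈v with ≈P-elim u≈v
  ... | ps , h = ≈P-intro (map negate ps) (λ A → trans (⊖-swap _ _) (trans (*-congˡ (h A)) (trans (∑-distribˡ ps (- 1#) _)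
      (trans (∑-cong ps (λ p → *-distribˡ-⊖ (- 1#) _ _)) (≡⇒≈ (≡.sym (∑-map negate ps _)))))))
    where
    negate : Relator → Relator
    negate p = proj₁ p , (λ A → (- 1#) * proj₂ p A)

  ≈P-+ : ∀ {u u' v v'} → u ≈P u' → v ≈P v' → (λ A → u A + v A) ≈P (λ A → u' A + v' A)
  ≈P-+ u≈u' v≈v' with ≈P-elim u≈u' | ≈P-elim v≈v'
  ... | ps , h | qs , h' = ≈P-intro (ps ++ qs) (λ A → trans (⊖-distrib-+ _ _ _ _) (trans (+-cong (h A) (h' A)) (sym (∑-++ ps qs _))))

  ≈P-· : ∀ a {u v} → u ≈P v → (λ A → a * u A) ≈P (λ A → a * v A)
  ≈P-· a {u} {v} u≈v with ≈P-elim u≈v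
  ... | ps , h = ≈P-intro (map scale ps) (λ A → trans (sym (*-distribˡ-⊖ a (u A) (v A))) (trans (*-congˡ (h A))
      (trans (∑-distribˡ ps a _) (trans (∑-cong ps (λ p → *-distribˡ-⊖ a _ _)) (≡⇒≈ (≡.sym (∑-map scale ps (λ q → relator q A))))))))
    where
    scale : Relator → Relator
    scale p = proj₁ p , (λ A → a * proj₂ p A)

  ≈P-∑ : ∀ {a} {X : Set a} (xs : List X) (a : X → Carrier) {f g : X → Vec Bool n → Carrier} → (∀ x → f x ≈P g x) →
    (λ A → ∑ xs (λ x → a x * f x A)) ≈P (λ A → ∑ xs (λ x → a x * g x A))
  ≈P-∑ [] a f≈g = ≈P-refl
  ≈P-∑ (x ∷ xs) a f≈g = ≈P-+ (≈P-· (a x) (f≈g x)) (≈P-∑ xs a f≈g)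

  ≈P-act : ∀ j w → actP K (lookup (Young blk) j) w ≈P w
  ≈P-act j w = ≈P-intro ((j , w) ∷ []) (λ A → sym (+-identityʳ _))

  coeffᴮ : (i : Fin k) → SetAlg.Carrier (W i) → Vec Bool n → Carrier
  coeffᴮ i w A = S.coeff i w (fromSubset blk A i)

  open ⊗.InducedFunctional coeffᴮ (λ i u v A → S.coeff-++ i u v _) (λ i b u A → S.coeff-·ᵗ i b u _) public
    renaming (Φ to ψ; Φ-++ to ψ-++; Φ-∑ᵗ to ψ-∑ᵗ; Φ-·ᵗ to ψ-·ᵗ; Φ-cong to ψ-respects; rest to restOf)

  ψ₁ : Carrier → ⊗.Tup → Vec Bool n → Carrier
  ψ₁ a t = ψ ((a , t) ∷ [])

  restOf-cong : ∀ t i A' A → (∀ i' → i' ≢ i → ∀ j → fromSubset blk A' i' j ≡ fromSubset blk A i' j) → restOf t i A' ≈ restOf t i A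
  restOf-cong t i A' A h = ∏-cong others
    where
    others : ∀ i' → (if i' == i then 1# else coeffᴮ i' (t i') A') ≈ (if i' == i then 1# else coeffᴮ i' (t i') A)
    others i' with i' ≟F i
    ... | yes _ = ≈-refl
    ... | no i'≢i = S.coeff-congʳ i' (t i') (h i' i'≢i)

  -- The Young element acting by σ⁻¹ on block i alone: through it a relation σ·w - w of the
  -- i-th tensor factor becomes a relation of ⟨P(x)⟩.
  module OnBlock (i : Fin k) (j : Fin (length (Sym (size i)))) where

    σ : Fin (size i) → Fin (size i)
    σ = lookup (Sym (size i)) j

    σ-injective : Injective _≡_ _≡_ σ
    σ-injective = All-lookup (All-Sym (size i)) j

    τ : BlockPerm
    τ = onBlock blk i (inverse σ)

    index : Fin (length (Young blk))
    index = proj₁ (lookup-Young (blockwise τ) (blockwise-young τ (onBlock-injective blk i _ (inverse-injective σ σ-injective))))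

    fromSubset-act : ∀ A i' j' → fromSubset blk (permuteVec A (lookup (Young blk) index)) i' j' ≡ fromSubset blk A i' (τ i' j')
    fromSubset-act A i' j' = ≡.trans (VecP.lookup∘tabulate _ (elem i' j'))
      (≡.cong (Vec.lookup A) (≡.trans (proj₂ (lookup-Young (blockwise τ) _) (elem i' j')) (blockwise-elem τ i' j')))

    coeff-act : ∀ w A → coeffᴮ i w (permuteVec A (lookup (Young blk) index)) ≈ S.coeff i (actT K σ w) (fromSubset blk A i)
    coeff-act w A = trans (S.coeff-congʳ i w (λ j' → ≡.trans (fromSubset-act A i j')
        (≡.cong (fromSubset blk A i) (≡.cong (λ π → π j') (update-same {F = λ i → Fin (size i) → Fin (size i)} _ i _)))))
      (sym (S.coeff-act i σ σ-injective w (fromSubset blk A i)))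

    restOf-act : ∀ t A → restOf t i (permuteVec A (lookup (Young blk) index)) ≈ restOf t i A
    restOf-act t A = restOf-cong t i (permuteVec A (lookup (Young blk) index)) A (λ i' i'≢i j' → ≡.trans (fromSubset-act A i' j')
      (≡.cong (fromSubset blk A i') (≡.cong (λ π → π j') (update-other {F = λ i → Fin (size i) → Fin (size i)} _ i _ i' i'≢i))))

  ψ₁-slot : ∀ a t i x → SetAlg._≈_ (W i) (t i) x → ψ₁ a t ≈P ψ₁ a (update t i x)
  ψ₁-slot a t i x t≈x = ≈P-intro (map relatorOf ps) λ A → begin
    ψ₁ a t A ⊖ ψ₁ a (update t i x) A
      ≈⟨ ⊖-cong (trans (+-identityʳ _) (*-congˡ (∏-punch (λ j → coeffᴮ j (t j) A) i)))
                (trans (+-identityʳ _) (*-congˡ (∏-update (λ j w → coeffᴮ j w A) t i x))) ⟩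
    a * (coeffᴮ i (t i) A * restOf t i A) ⊖ a * (coeffᴮ i x A * restOf t i A)
      ≈⟨ ⊖-cong (trans (*-congˡ (*-comm _ _)) (sym (*-assoc _ _ _))) (trans (*-congˡ (*-comm _ _)) (sym (*-assoc _ _ _))) ⟩
    (a * restOf t i A) * coeffᴮ i (t i) A ⊖ (a * restOf t i A) * coeffᴮ i x A
      ≈⟨ *-distribˡ-⊖ _ _ _ ⟨
    (a * restOf t i A) * (coeffᴮ i (t i) A ⊖ coeffᴮ i x A)
      ≈⟨ *-congˡ (proj₂ (S.coeff-≈S i {t i} {x} t≈x) (fromSubset blk A i)) ⟩
    (a * restOf t i A) * ∑ ps (λ p → S.coeff i (actT K (OnBlock.σ i (proj₁ p)) (proj₂ p)) (fromSubset blk A i) ⊖ coeffᴮ i (proj₂ p) A)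
      ≈⟨ ∑-distribˡ ps _ _ ⟩
    ∑ ps (λ p → (a * restOf t i A) * (S.coeff i (actT K (OnBlock.σ i (proj₁ p)) (proj₂ p)) (fromSubset blk A i) ⊖ coeffᴮ i (proj₂ p) A))
      ≈⟨ ∑-cong ps (λ p → trans (*-distribˡ-⊖ _ _ _) (⊖-cong (sym (*-cong (*-congˡ (OnBlock.restOf-act i (proj₁ p) t A))
                                                                       (OnBlock.coeff-act i (proj₁ p) (proj₂ p) A))) ≈-refl)) ⟩
    ∑ ps (λ p → relator (relatorOf p) A)
      ≡⟨ ∑-map relatorOf ps (λ q → relator q A) ⟨
    ∑ (map relatorOf ps) (λ q → relator q A) ∎
    where
    ps : List (S.Relator i)
    ps = proj₁ (S.coeff-≈S i {t i} {x} t≈x)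
    relatorOf : S.Relator i → Relator
    relatorOf (j , w) = OnBlock.index i j , λ A → (a * restOf t i A) * coeffᴮ i w A

  ψ₁-pointwise : ∀ a t t' → (∀ i → t i ≡ t' i) → ψ₁ a t ≈P ψ₁ a t'
  ψ₁-pointwise a t t' h = ≈P-pointwise (λ A → +-congʳ (*-congˡ (∏-cong (λ i → ≡⇒≈ (≡.cong (λ w → coeffᴮ i w A) (h i))))))

  overwrite : ⊗.Tup → ⊗.Tup → List (Fin k) → ⊗.Tup
  overwrite t t' [] = t
  overwrite t t' (i ∷ is) = update (overwrite t t' is) i (t' i)

  overwrite-≈ : ∀ t t' → (∀ i → SetAlg._≈_ (W i) (t i) (t' i)) → ∀ is i → SetAlg._≈_ (W i) (overwrite t t' is i) (t' i)
  overwrite-≈ t t' t≈t' [] i = t≈t' i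
  overwrite-≈ t t' t≈t' (i' ∷ is) i = by-cases (i ≟F i')
    where
    by-cases : Dec (i ≡ i') → SetAlg._≈_ (W i) (overwrite t t' (i' ∷ is) i) (t' i)
    by-cases (yes refl) = ≡.subst (λ w → SetAlg._≈_ (W i) w (t' i)) (≡.sym (update-same (overwrite t t' is) i (t' i))) (S.≈S-refl i (t' i))
    by-cases (no i≢i') = ≡.subst (λ w → SetAlg._≈_ (W i) w (t' i)) (≡.sym (update-other (overwrite t t' is) i' (t' i') i i≢i')) (overwrite-≈ t t' t≈t' is i)

  overwrite-∈ : ∀ t t' is i → i ∈ is → overwrite t t' is i ≡ t' i
  overwrite-∈ t t' (i' ∷ is) i i∈ = by-cases (i ≟F i') i∈
    where
    by-cases : Dec (i ≡ i') → i ∈ i' ∷ is → overwrite t t' (i' ∷ is) i ≡ t' i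
    by-cases (yes refl) _ = update-same (overwrite t t' is) i (t' i)
    by-cases (no i≢i') (here i≡i') = ⊥-elim (i≢i' i≡i')
    by-cases (no i≢i') (there i∈is) = ≡.trans (update-other (overwrite t t' is) i' (t' i') i i≢i') (overwrite-∈ t t' is i i∈is)

  ψ₁-slots : ∀ a t t' → (∀ i → SetAlg._≈_ (W i) (t i) (t' i)) → ψ₁ a t ≈P ψ₁ a t'
  ψ₁-slots a t t' t≈t' = ≈P-trans (go (allFin k)) (ψ₁-pointwise a _ t' (λ i → overwrite-∈ t t' (allFin k) i (∈-allFin i)))
    where
    go : ∀ is → ψ₁ a t ≈P ψ₁ a (overwrite t t' is)
    go [] = ≈P-refl
    go (i ∷ is) = ≈P-trans (go is) (ψ₁-slot a (overwrite t t' is) i (t' i) (overwrite-≈ t t' t≈t' is i))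

  ψ-cong : ∀ {w w'} → w ⊗.~ w' → ψ w ≈P ψ w'
  ψ-cong = ψ-respects _≈P_ ≈P-pointwise ≈P-sym ≈P-trans ≈P-+ ψ₁-slots

  ψ-φ : ∀ f A → ψ (φ f) A ≈ f A
  ψ-φ f A = begin
    ψ (φ f) A                                                                 ≈⟨ ψ-∑ᵗ (blockSubsets blk) _ A ⟩
    ∑ (blockSubsets blk) (λ B → ψ₁ (f (toSubset blk B)) (pureᴮ B) A)          ≈⟨ ∑-cong (blockSubsets blk) coefficient ⟩
    ∑ (blockSubsets blk) (λ B → [ eqᴮ blk B (fromSubset blk A) ] * f (toSubset blk B))
      ≈⟨ ∑-select (blockSubsets blk) (λ B → eqᴮ blk B (fromSubset blk A)) _ (f A) (count-blockSubsets blk (fromSubset blk A))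
           (λ B e → ≡⇒≈ (≡.cong f (≡.trans (toSubset-cong blk (eqᴮ⇒≗ blk e)) (toSubset-fromSubset blk A)))) ⟩
    f A                                                                       ∎
    where
    coefficient : ∀ B → ψ₁ (f (toSubset blk B)) (pureᴮ B) A ≈ [ eqᴮ blk B (fromSubset blk A) ] * f (toSubset blk B)
    coefficient B = trans (+-identityʳ _) (trans (*-congˡ (trans (∏-cong (λ i → S.coeff-pure i (B i) (fromSubset blk A i)))
      (∏-indicator (λ i → eqᶠ _≟B_ (B i) (fromSubset blk A i))))) (*-comm _ _))

  φ-ψ : ∀ w → φ (ψ w) ⊗.~ w
  φ-ψ w = ⊗.~sym (⊗.~trans
    (Expansion.expand-term K W S.≈S-refl (λ i → [] , S.≈S-refl i []) (λ i → tuples (λ _ → bools)) S.coeff S.pure S.expand-pure w)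
    (⊗.∑ᵗ.∑-cong (blockSubsets blk) (λ B → ⊗.~coef (pureᴮ B) (∑-cong w (λ p → *-congˡ (∏-cong (λ i →
      S.coeff-congʳ i (proj₂ p i) (λ j → ≡.sym (fromSubset-toSubset blk B i j)))))))))

  φ-pointwise : ∀ {f g} → (∀ A → f A ≈ g A) → φ f ⊗.~ φ g
  φ-pointwise f≈g = ⊗.∑ᵗ.∑-cong (blockSubsets blk) (λ B → ⊗.~coef (pureᴮ B) (f≈g (toSubset blk B)))

  φ-+ : ∀ f g → φ (λ A → f A + g A) ⊗.~ (φ f ++ φ g)
  φ-+ f g = ⊗.~trans (⊗.∑ᵗ.∑-cong (blockSubsets blk) (λ B → ⊗.~sym (⊗.~addc _ _ (pureᴮ B)))) (⊗.∑ᵗ.∑-∙ (blockSubsets blk) _ _)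

  φ-· : ∀ a f → φ (λ A → a * f A) ⊗.~ a ⊗.·ᵗ φ f
  φ-· a f = ⊗.≡⇒~ (go (blockSubsets blk))
    where
    go : ∀ Bs → ⊗.∑ᵗ Bs (λ B → (a * f (toSubset blk B) , pureᴮ B) ∷ []) ≡ a ⊗.·ᵗ ⊗.∑ᵗ Bs (λ B → (f (toSubset blk B) , pureᴮ B) ∷ [])
    go [] = refl
    go (B ∷ Bs) = ≡.cong (_ ∷_) (go Bs)

  φ-∑ : {X : Set c} (xs : List X) (G : X → Vec Bool n → Carrier) → φ (λ A → ∑ xs (λ x → G x A)) ⊗.~ ⊗.∑ᵗ xs (φ ∘ G)
  φ-∑ [] G = ⊗.~trans (φ-pointwise (λ _ → sym (zeroˡ 1#))) (⊗.~trans (φ-· 0# (λ _ → 1#)) (⊗.0·ᵗs~[] _))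
  φ-∑ (x ∷ xs) G = ⊗.~trans (φ-+ (G x) (λ A → ∑ xs (λ x → G x A))) (⊗.~++ {s = φ (G x)} ⊗.~refl (φ-∑ xs G))

  φ-act : ∀ j w → φ (actP K (lookup (Young blk) j) w) ⊗.~ φ w
  φ-act j w = ∑-permuteᴮ ⊗.Term-commutativeMonoid _ _
      (λ B≗B' → ⊗.~trans (⊗.~coef _ (≡⇒≈ (≡.cong w (toSubset-cong blk B≗B'))))
                         (⊗.~slot _ (λ i → S.pure-cong i (B≗B' i))))
      (λ B → ⊗.~trans (⊗.~coef _ (≡⇒≈ (≡.cong w (toSubset-permuteᴮ B)))) (⊗.~slot _ (pure-permuted B)))
    where
    g : Fin n → Fin n
    g = lookup (Young blk) j
    young : IsYoung g
    young = All-lookup All-Young j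
    open YoungAction blk g young
    pure-permuted : ∀ B i → SetAlg._≈_ (W i) (pureᴮ B i) (pureᴮ (permuteᴮ B) i)
    pure-permuted B i = let σ , σ≗ρ⁻¹ = lookup-Sym (inverse (ρ i)) (inverse-injective (ρ i) (ρ-injective i)) in
      S.pure-permute i (B i) (permuteᴮ B i) σ
        (λ x → ≡.trans (≡.cong (B i ∘ ρ i) (σ≗ρ⁻¹ x)) (≡.cong (B i) (inverseʳ (ρ i) (ρ-injective i) x)))

  φ-relator : ∀ p → φ (relator p) ⊗.~ []
  φ-relator (j , w) = ⊗.~trans (φ-+ (actP K (lookup (Young blk) j) w) (λ A → (- 1#) * w A))
    (⊗.~trans (⊗.~++ (φ-act j w) (φ-· (- 1#) w)) (⊗.s-s~[] (φ w)))

  φ-cong : ∀ {u v} → u ≈P v → φ u ⊗.~ φ v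
  φ-cong {u} {v} u≈v with ≈P-elim u≈v
  ... | ps , h =
    ⊗.~trans (φ-pointwise (λ A → trans (sym (+-⊖ (u A) (v A))) (+-congˡ (h A))))
      (⊗.~trans (φ-+ v (λ A → ∑ ps (λ p → relator p A)))
        (⊗.~trans (⊗.~++ {s = φ v} ⊗.~refl (⊗.~trans (φ-∑ ps relator) (⊗.~trans (⊗.∑ᵗ.∑-cong ps φ-relator) (⊗.∑ᵗ.∑-ε ps))))
          (⊗.≡⇒~ (ListP.++-identityʳ (φ v)))))

  φ-injective : ∀ {u v} → φ u ⊗.~ φ v → u ≈P v
  φ-injective {u} {v} φu~φv = ≈P-trans (≈P-pointwise (λ A → sym (ψ-φ u A))) (≈P-trans (ψ-cong φu~φv) (≈P-pointwise (ψ-φ v)))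

-- Averages over the Young subgroup

module YoungSums {c ℓ} (K : Field c ℓ) {n k : ℕ} (blk : Fin n → Fin k) where
  open FieldFacts K
  open Blocks blk

  ∑-toSubset : (F : Vec Bool n → Carrier) → ∑ (allSubsets n) F ≈ ∑ (blockSubsets blk) (F ∘ toSubset blk)
  ∑-toSubset F = ∑-reindex (allSubsets n) (blockSubsets blk) (λ a B → eqᵇ _≟V_ a (toSubset blk B)) F (F ∘ toSubset blk)
    (All.universal (λ a → ≡.trans (count-cong _ (λ B → eqᴮ blk B (fromSubset blk a)) (blockSubsets blk)
        (All.universal (λ B → ≡.trans (eqᵇ-sym _≟V_ a (toSubset blk B)) (eqᵇ-toSubset blk B a)) _))
      (count-blockSubsets blk (fromSubset blk a))) _)
    (All.universal (λ B → count-allSubsets n (toSubset blk B)) _)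
    (All.universal (λ a → All.universal (λ B e → ≡⇒≈ (≡.cong F (eqᵇ⇒≡ _≟V_ e))) _) _)

  blockPerms : List BlockPerm
  blockPerms = tuples (λ i → Sym (size i))

  All-blockPerms : All (λ τ → ∀ i → Injective _≡_ _≡_ (τ i)) blockPerms
  All-blockPerms = All-tuples (λ i → Sym (size i)) (λ i f → Injective _≡_ _≡_ f) (λ i → All-Sym (size i))

  ∑-Young : (Φ : BlockPerm → Carrier) →
    (∀ τ τ' → (∀ i → Injective _≡_ _≡_ (τ' i)) → (∀ i j → τ i j ≡ τ' i j) → Φ τ ≈ Φ τ') →
    ∑ (Young blk) (Φ ∘ restrictPerm) ≈ ∑ blockPerms Φ
  ∑-Young Φ Φ-cong = ∑-reindex (Young blk) blockPerms R (Φ ∘ restrictPerm) Φ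
    (All.map (λ {g} young → ≡.trans (count-cong (R g) (λ τ → eqτ τ (restrictPerm g)) blockPerms (All.universal (R-restrictPerm g young) _))
                (≡.trans (count-tuples (λ i → Sym (size i)) (λ i f → eqᶠ _≟F_ f (restrictPerm g i)))
                         (prodF-1 _ (λ i → count-Sym (restrictPerm g i) (restrictPerm-injective g young i))))) All-Young)
    (All.map (λ {τ} τ-inj → count-Young (blockwise τ) (blockwise-young τ τ-inj)) All-blockPerms)
    (All.map (λ {g} young → All.map (λ {τ} τ-inj e → Φ-cong _ τ τ-inj
        (λ i j → ≡.trans (restrictPerm-cong g (blockwise τ) (eqᶠ⇒≗ _≟F_ e) i j) (restrictPerm-blockwise τ i j))) All-blockPerms) All-Young)
    where
    R : (Fin n → Fin n) → BlockPerm → Bool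
    R g τ = eqᶠ _≟F_ g (blockwise τ)
    eqτ : BlockPerm → BlockPerm → Bool
    eqτ τ τ' = andF (λ i → eqᶠ _≟F_ (τ i) (τ' i))
    R-restrictPerm : ∀ g → IsYoung g → ∀ τ → R g τ ≡ eqτ τ (restrictPerm g)
    R-restrictPerm g young τ = true-iff⇒≡
      (λ e → ⇒andF _ (λ i → ≗⇒eqᶠ _≟F_ (λ j → ≡.sym (≡.trans (restrictPerm-cong g (blockwise τ) (eqᶠ⇒≗ _≟F_ e) i j) (restrictPerm-blockwise τ i j)))))
      (λ e → ≗⇒eqᶠ _≟F_ (λ x → ≡.trans (≡.sym (blockwise-restrictPerm g young x))
                                         (≡.sym (blockwise-cong τ (restrictPerm g) (λ i → eqᶠ⇒≗ _≟F_ (andF⇒ _ e i)) x))))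

  ∑-Sym-inverse : ∀ m (G : (Fin m → Fin m) → Carrier) → (∀ f f' → (∀ j → f j ≡ f' j) → G f ≈ G f') →
    ∑ (Sym m) (G ∘ inverse) ≈ ∑ (Sym m) G
  ∑-Sym-inverse m G G-cong = ∑-reindex (Sym m) (Sym m) R (G ∘ inverse) G
    (All.map count-R (All-Sym m)) (All.map count-R⁻¹ (All-Sym m))
    (All.universal (λ σ → All.universal (λ σ' e → G-cong _ _ (λ j → ≡.sym (eqᶠ⇒≗ _≟F_ e j))) _) _)
    where
    R : (Fin m → Fin m) → (Fin m → Fin m) → Bool
    R σ σ' = eqᶠ _≟F_ σ' (inverse σ)
    inverse-swap : ∀ σ σ' → Injective _≡_ _≡_ σ → Injective _≡_ _≡_ σ' → (∀ j → σ' j ≡ inverse σ j) → ∀ j → σ j ≡ inverse σ' j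
    inverse-swap σ σ' σ-inj σ'-inj h j =
      ≡.trans (≡.sym (inverseˡ σ' σ'-inj (σ j))) (≡.cong (inverse σ') (≡.trans (h (σ j)) (inverseˡ σ σ-inj j)))
    R-swap : ∀ σ σ' → Injective _≡_ _≡_ σ → Injective _≡_ _≡_ σ' → R σ σ' ≡ eqᶠ _≟F_ σ (inverse σ')
    R-swap σ σ' σ-inj σ'-inj = true-iff⇒≡ (λ e → ≗⇒eqᶠ _≟F_ (inverse-swap σ σ' σ-inj σ'-inj (eqᶠ⇒≗ _≟F_ e)))
                                          (λ e → ≗⇒eqᶠ _≟F_ (inverse-swap σ' σ σ'-inj σ-inj (eqᶠ⇒≗ _≟F_ e)))
    count-R : ∀ {σ} → Injective _≡_ _≡_ σ → count (R σ) (Sym m) ≡ 1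
    count-R {σ} σ-inj = count-Sym (inverse σ) (inverse-injective σ σ-inj)
    count-R⁻¹ : ∀ {σ'} → Injective _≡_ _≡_ σ' → count (λ σ → R σ σ') (Sym m) ≡ 1
    count-R⁻¹ {σ'} σ'-inj = ≡.trans (count-cong (λ σ → R σ σ') (λ σ → eqᶠ _≟F_ σ (inverse σ')) (Sym m) (All.map swap (All-Sym m)))
                                    (count-Sym (inverse σ') (inverse-injective σ' σ'-inj))
      where
      swap : ∀ {σ} → Injective _≡_ _≡_ σ → R σ σ' ≡ eqᶠ _≟F_ σ (inverse σ')
      swap {σ} σ-inj = R-swap σ σ' σ-inj σ'-inj

  #Young : Carrier
  #Young = ι (length (Young blk))

  #Sym : Fin k → Carrier
  #Sym i = ι (length (Sym (size i)))

  #Young≈∏#Sym : #Young ≈ ∏ #Sym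
  #Young≈∏#Sym = begin
    #Young                                       ≈⟨ ∑-1 (Young blk) ⟨
    ∑ (Young blk) (λ _ → 1#)                      ≈⟨ ∑-cong (Young blk) (λ _ → ∏-1 k) ⟨
    ∑ (Young blk) (λ g → ∏ {k} (λ _ → 1#))        ≈⟨ ∑-Young (λ _ → ∏ {k} (λ _ → 1#)) (λ _ _ _ _ → ≈-refl) ⟩
    ∑ blockPerms (λ τ → ∏ {k} (λ _ → 1#))         ≈⟨ ∑-tuples (λ i → Sym (size i)) (λ i _ → 1#) ⟩
    ∏ (λ i → ∑ (Sym (size i)) (λ _ → 1#))         ≈⟨ ∏-cong (λ i → ∑-1 (Sym (size i))) ⟩
    ∏ #Sym                                      ∎

  module _ (char-0 : CharZero K) where

    ι-length≉0 : (xs : List A) → Fin (length xs) → ¬ (ι (length xs) ≈ 0#)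
    ι-length≉0 (x ∷ xs) _ = char-0 (length xs)

    #Young⁻¹≈∏#Sym⁻¹ : #Young ⁻¹ ≈ ∏ (λ i → #Sym i ⁻¹)
    #Young⁻¹≈∏#Sym⁻¹ = sym (inverse-unique #Young _ #Young≉0
      (trans (*-congʳ #Young≈∏#Sym) (trans (sym (∏-distrib-* #Sym (λ i → #Sym i ⁻¹)))
        (trans (∏-cong (λ i → ⁻¹-inverseʳ (#Sym i) (#Sym≉0 i))) (∏-1 k)))))
      where
      #Young≉0 : ¬ (#Young ≈ 0#)
      #Young≉0 = ι-length≉0 (Young blk) (proj₁ (lookup-Young id (id , (λ _ → refl))))
      #Sym≉0 : ∀ i → ¬ (#Sym i ≈ 0#)
      #Sym≉0 i = ι-length≉0 (Sym (size i)) (proj₁ (lookup-Sym {size i} id id))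

zipWith-tabulate : ∀ {n} (f : Bool → Bool → Bool) (g h : Fin n → Bool) →
  Vec.zipWith f (Vec.tabulate g) (Vec.tabulate h) ≡ Vec.tabulate (λ i → f (g i) (h i))
zipWith-tabulate {zero} f g h = refl
zipWith-tabulate {suc n} f g h = ≡.cong (f (g zero) (h zero) ∷_) (zipWith-tabulate f (g ∘ suc) (h ∘ suc))

module Operations {c ℓ} (K : Field c ℓ) (char-0 : CharZero K) {n k : ℕ} (blk : Fin n → Fin k) where
  open FieldFacts K
  open Blocks blk
  open Isomorphism K blk
  open YoungSums K blk
  open PowerSetBasis K {n} using (ΣV-apply)

  if≈[]* : ∀ b b' {X X'} → b ≡ b' → X ≈ X' → (if b then X else 0#) ≈ [ b' ] * X'
  if≈[]* true .true refl X≈X' = trans X≈X' (sym (*-identityˡ _))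
  if≈[]* false .false refl X≈X' = sym (zeroˡ _)

  module BlockwiseOperation (_•_ : Bool → Bool → Bool) (_⊙_ : Vec Bool n → Vec Bool n → Vec Bool n)
      (⊙-toSubset : ∀ B B' → toSubset blk B ⊙ toSubset blk B' ≡ toSubset blk (λ i j → B i j • B' i j)) where

    Bs : List (BlockSubset blk)
    Bs = blockSubsets blk

    average : (i : Fin k) → (Fin (size i) → Bool) → (Fin (size i) → Bool) → (Fin (size i) → Bool) → Carrier
    average i β β' γ = #Sym i ⁻¹ * ∑ (Sym (size i)) (λ σ → [ eqᶠ _≟B_ (λ j → β j • β' (σ j)) γ ])

    target : (Vec Bool n → Carrier) → (Vec Bool n → Carrier) → Vec Bool n → Carrier
    target u v A = ∑ Bs (λ B → ∑ Bs (λ B' → (u (toSubset blk B) * v (toSubset blk B')) * ∏ (λ i → average i (B i) (B' i) (fromSubset blk A i))))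

    matches : (Fin n → Fin n) → BlockSubset blk → BlockSubset blk → Vec Bool n → Bool
    matches g B B' A = eqᴮ blk (λ i j → B i j • B' i (inverse (restrictPerm g i) j)) (fromSubset blk A)

    summand : (u v : Vec Bool n → Carrier) → Vec Bool n → (Fin n → Fin n) → Vec Bool n → Vec Bool n → Carrier
    summand u v A g a a' = if eqᵇ _≟V_ (a ⊙ a') A then u a * v (permuteVec a' g) else 0#

    sum-for-young : ∀ u v A g → IsYoung g → ∑ (allSubsets n) (λ a → ∑ (allSubsets n) (summand u v A g a)) ≈
      ∑ Bs (λ B → ∑ Bs (λ B' → [ matches g B B' A ] * (u (toSubset blk B) * v (toSubset blk B'))))
    sum-for-young u v A g young = begin
      ∑ (allSubsets n) (λ a → ∑ (allSubsets n) (summand u v A g a))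
        ≈⟨ ∑-toSubset _ ⟩
      ∑ Bs (λ B → ∑ (allSubsets n) (summand u v A g (toSubset blk B)))
        ≈⟨ ∑-cong Bs (λ B → ∑-toSubset _) ⟩
      ∑ Bs (λ B → ∑ Bs (λ B' → summand u v A g (toSubset blk B) (toSubset blk B')))
        ≈⟨ ∑-cong Bs (λ B → ∑-cong Bs (λ B' → if≈[]* _ _
             (≡.trans (≡.cong (λ z → eqᵇ _≟V_ z A) (⊙-toSubset B B')) (eqᵇ-toSubset blk _ A))
             (≡⇒≈ (≡.cong (λ z → u (toSubset blk B) * v z) (toSubset-permuteᴮ B'))))) ⟩
      ∑ Bs (λ B → ∑ Bs (λ B' → [ eqᴮ blk (λ i j → B i j • B' i j) (fromSubset blk A) ] * (u (toSubset blk B) * v (toSubset blk (permuteᴮ B')))))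
        ≈⟨ ∑-cong Bs (λ B → ∑-permuteᴮ +-commutativeMonoid _ _ (G-cong B) (λ B' → *-congʳ (≡⇒≈ (≡.cong [_] (eqᴮ-permute B B'))))) ⟩
      ∑ Bs (λ B → ∑ Bs (λ B' → [ matches g B B' A ] * (u (toSubset blk B) * v (toSubset blk B')))) ∎
      where
      open YoungAction blk g young
      G-cong : ∀ B {B' B''} → (∀ i j → B' i j ≡ B'' i j) →
        [ matches g B B' A ] * (u (toSubset blk B) * v (toSubset blk B')) ≈ [ matches g B B'' A ] * (u (toSubset blk B) * v (toSubset blk B''))
      G-cong B B'≗B'' = *-cong (≡⇒≈ (≡.cong [_] (andF-cong _ _ (λ i → andF-cong _ _ (λ j →
          ≡.cong (λ b → eqᵇ _≟B_ (B i j • b) (fromSubset blk A i j)) (B'≗B'' i _))))))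
        (≡⇒≈ (≡.cong (λ z → u (toSubset blk B) * v z) (toSubset-cong blk B'≗B'')))
      eqᴮ-permute : ∀ B B' → eqᴮ blk (λ i j → B i j • B' i j) (fromSubset blk A) ≡ matches g B (permuteᴮ B') A
      eqᴮ-permute B B' = andF-cong _ _ (λ i → andF-cong _ _ (λ j →
        ≡.cong (λ x → eqᵇ _≟B_ (B i j • B' i x) (fromSubset blk A i j)) (≡.sym (inverseʳ (ρ i) (ρ-injective i) j))))

    average-matches : ∀ B B' A → #Young ⁻¹ * ∑ (Young blk) (λ g → [ matches g B B' A ]) ≈ ∏ (λ i → average i (B i) (B' i) (fromSubset blk A i))
    average-matches B B' A = begin
      #Young ⁻¹ * ∑ (Young blk) (λ g → [ matches g B B' A ])
        ≈⟨ *-congˡ (∑-cong (Young blk) (λ g → sym (∏-indicator (λ i → eqᶠ _≟B_ (λ j → B i j • B' i (inverse (restrictPerm g i) j)) (fromSubset blk A i))))) ⟩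
      #Young ⁻¹ * ∑ (Young blk) (Γ ∘ restrictPerm)
        ≈⟨ *-congˡ (∑-Young Γ Γ-cong) ⟩
      #Young ⁻¹ * ∑ blockPerms Γ
        ≈⟨ *-congˡ (∑-tuples (λ i → Sym (size i)) (λ i σ → G i (inverse σ))) ⟩
      #Young ⁻¹ * ∏ (λ i → ∑ (Sym (size i)) (G i ∘ inverse))
        ≈⟨ *-cong (#Young⁻¹≈∏#Sym⁻¹ char-0) (∏-cong (λ i → ∑-Sym-inverse (size i) (G i) (G-cong i))) ⟩
      ∏ (λ i → #Sym i ⁻¹) * ∏ (λ i → ∑ (Sym (size i)) (G i))
        ≈⟨ ∏-distrib-* (λ i → #Sym i ⁻¹) (λ i → ∑ (Sym (size i)) (G i)) ⟨
      ∏ (λ i → average i (B i) (B' i) (fromSubset blk A i)) ∎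
      where
      G : (i : Fin k) → (Fin (size i) → Fin (size i)) → Carrier
      G i σ = [ eqᶠ _≟B_ (λ j → B i j • B' i (σ j)) (fromSubset blk A i) ]
      G-cong : ∀ i σ σ' → (∀ j → σ j ≡ σ' j) → G i σ ≈ G i σ'
      G-cong i σ σ' σ≗σ' = ≡⇒≈ (≡.cong [_] (andF-cong _ _ (λ j → ≡.cong (λ x → eqᵇ _≟B_ (B i j • B' i x) (fromSubset blk A i j)) (σ≗σ' j))))
      Γ : BlockPerm → Carrier
      Γ τ = ∏ (λ i → G i (inverse (τ i)))
      Γ-cong : ∀ τ τ' → (∀ i → Injective _≡_ _≡_ (τ' i)) → (∀ i j → τ i j ≡ τ' i j) → Γ τ ≈ Γ τ'
      Γ-cong τ τ' τ'-inj τ≗τ' = ∏-cong (λ i → G-cong i _ _ (inverse-cong (τ i) (τ' i) (τ'-inj i) (τ≗τ' i)))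

    exchange : (x : Carrier) (f : (Fin n → Fin n) → BlockSubset blk → BlockSubset blk → Carrier) (h : BlockSubset blk → BlockSubset blk → Carrier) →
      x * ∑ (Young blk) (λ g → ∑ Bs (λ B → ∑ Bs (λ B' → f g B B' * h B B'))) ≈ ∑ Bs (λ B → ∑ Bs (λ B' → h B B' * (x * ∑ (Young blk) (λ g → f g B B'))))
    exchange x f h = begin
      x * ∑ (Young blk) (λ g → ∑ Bs (λ B → ∑ Bs (λ B' → f g B B' * h B B')))  ≈⟨ *-congˡ (trans (∑-swap (Young blk) Bs _) (∑-cong Bs (λ B → ∑-swap (Young blk) Bs _))) ⟩
      x * ∑ Bs (λ B → ∑ Bs (λ B' → ∑ (Young blk) (λ g → f g B B' * h B B')))  ≈⟨ trans (∑-distribˡ Bs x _) (∑-cong Bs (λ B → ∑-distribˡ Bs x _)) ⟩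
      ∑ Bs (λ B → ∑ Bs (λ B' → x * ∑ (Young blk) (λ g → f g B B' * h B B')))  ≈⟨ ∑-cong Bs (λ B → ∑-cong Bs (λ B' → rearrange B B')) ⟩
      ∑ Bs (λ B → ∑ Bs (λ B' → h B B' * (x * ∑ (Young blk) (λ g → f g B B')))) ∎
      where
      rearrange : ∀ B B' → x * ∑ (Young blk) (λ g → f g B B' * h B B') ≈ h B B' * (x * ∑ (Young blk) (λ g → f g B B'))
      rearrange B B' = trans (*-congˡ (trans (sym (∑-distribʳ (Young blk) (h B B') _)) (*-comm _ _))) (x∙yz≈y∙xz _ _ _)

    average-evaluates : ∀ u v A → #Young ⁻¹ * ∑ (Young blk) (λ g → ∑ (allSubsets n) (λ a → ∑ (allSubsets n) (summand u v A g a))) ≈ target u v A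
    average-evaluates u v A = begin
      #Young ⁻¹ * ∑ (Young blk) (λ g → ∑ (allSubsets n) (λ a → ∑ (allSubsets n) (summand u v A g a)))
        ≈⟨ *-congˡ (∑-cong-All (All.map (λ {g} → sum-for-young u v A g) All-Young)) ⟩
      #Young ⁻¹ * ∑ (Young blk) (λ g → ∑ Bs (λ B → ∑ Bs (λ B' → [ matches g B B' A ] * (u (toSubset blk B) * v (toSubset blk B')))))
        ≈⟨ exchange (#Young ⁻¹) (λ g B B' → [ matches g B B' A ]) (λ B B' → u (toSubset blk B) * v (toSubset blk B')) ⟩
      ∑ Bs (λ B → ∑ Bs (λ B' → (u (toSubset blk B) * v (toSubset blk B')) * (#Young ⁻¹ * ∑ (Young blk) (λ g → [ matches g B B' A ]))))
        ≈⟨ ∑-cong Bs (λ B → ∑-cong Bs (λ B' → *-congˡ (average-matches B B' A))) ⟩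
      target u v A ∎

    ψ-operation : (_⊙ᵢ_ : (i : Fin k) → SetAlg.Carrier (W i) → SetAlg.Carrier (W i) → SetAlg.Carrier (W i)) →
      (∀ i β β' γ → S.coeff i (_⊙ᵢ_ i (S.pure i β) (S.pure i β')) γ ≈ average i β β' γ) →
      ∀ u v A → ψ (⊗.bilinT _⊙ᵢ_ (φ u) (φ v)) A ≈ target u v A
    ψ-operation _⊙ᵢ_ coeff-⊙ u v A = begin
      ψ (⊗.bilinT _⊙ᵢ_ (φ u) (φ v)) A                    ≡⟨ ≡.cong₂ (λ s t → ψ (⊗.bilinT _⊙ᵢ_ s t) A) (⊗.∑ᵗ-∷[] Bs termᵘ) (⊗.∑ᵗ-∷[] Bs termᵛ) ⟩
      ∑ (concatMap pairs (map termᵘ Bs)) value             ≈⟨ ∑-concatMap pairs (map termᵘ Bs) value ⟩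
      ∑ (map termᵘ Bs) (λ p → ∑ (pairs p) value)           ≡⟨ ∑-map termᵘ Bs _ ⟩
      ∑ Bs (λ B → ∑ (pairs (termᵘ B)) value)               ≈⟨ ∑-cong Bs (λ B → ≡⇒≈ (≡.trans (∑-map (pair (termᵘ B)) (map termᵛ Bs) value) (∑-map termᵛ Bs _))) ⟩
      ∑ Bs (λ B → ∑ Bs (λ B' → value (pair (termᵘ B) (termᵛ B'))))
        ≈⟨ ∑-cong Bs (λ B → ∑-cong Bs (λ B' → *-congˡ (∏-cong (λ i → coeff-⊙ i (B i) (B' i) (fromSubset blk A i))))) ⟩
      target u v A ∎
      where
      termᵘ termᵛ : BlockSubset blk → Carrier × ⊗.Tup
      termᵘ B = u (toSubset blk B) , pureᴮ B
      termᵛ B = v (toSubset blk B) , pureᴮ B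
      pair : Carrier × ⊗.Tup → Carrier × ⊗.Tup → Carrier × ⊗.Tup
      pair p q = proj₁ p * proj₁ q , λ i → _⊙ᵢ_ i (proj₂ p i) (proj₂ q i)
      pairs : Carrier × ⊗.Tup → ⊗.Term
      pairs p = map (pair p) (map termᵛ Bs)
      value : Carrier × ⊗.Tup → Carrier
      value p = proj₁ p * ∏ (λ i → coeffᴮ i (proj₂ p i) A)

  module Union = BlockwiseOperation _∨_ Sub._∪_ (λ B B' → zipWith-tabulate _∨_ (assemble B) (assemble B'))
  module Intersection = BlockwiseOperation _∧_ Sub._∩_ (λ B B' → zipWith-tabulate _∧_ (assemble B) (assemble B'))

  φ-∪ : ∀ u v → φ (SetAlg._∪_ (⟨P⟩/Young K blk) u v) ⊗.~ SetAlg._∪_ (⊗Sym K blk) (φ u) (φ v)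
  φ-∪ u v = ⊗.~trans (φ-pointwise (λ A → trans (lhs A) (sym (Union.ψ-operation (λ i → SetAlg._∪_ (W i)) (λ i → S.coeff-∪ i) u v A)))) (φ-ψ _)
    where
    lhs : ∀ A → SetAlg._∪_ (⟨P⟩/Young K blk) u v A ≈ Union.target u v A
    lhs A = trans (*-congˡ (≡⇒≈ (ΣV-apply (Young blk) (λ g → SetAlg._∪_ (⟨P⟩ K n) u (actP K g v)) A))) (Union.average-evaluates u v A)

  φ-∩ : ∀ u v → φ (SetAlg._∩_ (⟨P⟩/Young K blk) u v) ⊗.~ SetAlg._∩_ (⊗Sym K blk) (φ u) (φ v)
  φ-∩ u v = ⊗.~trans (φ-pointwise (λ A → trans (lhs A) (sym (Intersection.ψ-operation (λ i → SetAlg._∩_ (W i)) (λ i → S.coeff-∩ i) u v A)))) (φ-ψ _)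
    where
    lhs : ∀ A → SetAlg._∩_ (⟨P⟩/Young K blk) u v A ≈ Intersection.target u v A
    lhs A = trans (*-congˡ (≡⇒≈ (ΣV-apply (Young blk) (λ g → SetAlg._∩_ (⟨P⟩ K n) u (actP K g v)) A))) (Intersection.average-evaluates u v A)

  φ-∁ : ∀ v → φ (SetAlg.∁ (⟨P⟩/Young K blk) v) ⊗.~ SetAlg.∁ (⊗Sym K blk) (φ v)
  φ-∁ v = ⊗.~trans (φ-pointwise (λ A → trans (lhs A) (sym (rhs A)))) (φ-ψ _)
    where
    ∁ᴮ : BlockSubset blk → BlockSubset blk
    ∁ᴮ B i j = not (B i j)
    lhs : ∀ A → SetAlg.∁ (⟨P⟩/Young K blk) v A ≈ ∑ (blockSubsets blk) (λ B → v (toSubset blk B) * [ eqᴮ blk (∁ᴮ B) (fromSubset blk A) ])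
    lhs A = trans (∑-toSubset (λ a → if eqᵇ _≟V_ (Sub.∁ a) A then v a else 0#))
      (∑-cong (blockSubsets blk) (λ B → trans (if≈[]* _ _
        (≡.trans (≡.cong (λ z → eqᵇ _≟V_ z A) (≡.sym (VecP.tabulate-∘ not (assemble B)))) (eqᵇ-toSubset blk (∁ᴮ B) A)) ≈-refl) (*-comm _ _)))
    rhs : ∀ A → ψ (SetAlg.∁ (⊗Sym K blk) (φ v)) A ≈ ∑ (blockSubsets blk) (λ B → v (toSubset blk B) * [ eqᴮ blk (∁ᴮ B) (fromSubset blk A) ])
    rhs A = trans (≡⇒≈ (≡.trans (≡.cong (λ s → ψ (SetAlg.∁ (⊗Sym K blk) s) A) (⊗.∑ᵗ-∷[] (blockSubsets blk) termᵛ))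
                                (≡.trans (∑-map complement (map termᵛ (blockSubsets blk)) value) (∑-map termᵛ (blockSubsets blk) (value ∘ complement)))))
      (∑-cong (blockSubsets blk) (λ B → *-congˡ (trans (∏-cong (λ i → S.coeff-∁ i (B i) (fromSubset blk A i)))
                                                      (∏-indicator (λ i → eqᶠ _≟B_ (∁ᴮ B i) (fromSubset blk A i))))))
      where
      termᵛ : BlockSubset blk → Carrier × ⊗.Tup
      termᵛ B = v (toSubset blk B) , pureᴮ B
      complement : Carrier × ⊗.Tup → Carrier × ⊗.Tup
      complement p = proj₁ p , λ i → SetAlg.∁ (W i) (proj₂ p i)
      value : Carrier × ⊗.Tup → Carrier
      value p = proj₁ p * ∏ (λ i → coeffᴮ i (proj₂ p i) A)

  isomorphism : AlgIso (⟨P⟩/Young K blk) (⊗Sym K blk)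
  isomorphism = record
    { φ = φ
    ; φ-cong = φ-cong
    ; φ-+ = φ-+
    ; φ-· = φ-·
    ; φ-inj = φ-injective
    ; φ-surj = λ w → ψ w , φ-ψ w
    ; φ-∪ = φ-∪
    ; φ-∩ = φ-∩
    ; φ-∁ = φ-∁
    }

-- The orbit basis

permutation-injective : {m : ℕ} (π : Permutation m m) → Injective _≡_ _≡_ (π ⟨$⟩ʳ_)
permutation-injective π {x} {y} e = ≡.trans (≡.sym (Perm.inverseˡ π)) (≡.trans (≡.cong (π ⟨$⟩ˡ_) e) (Perm.inverseˡ π))

module Dimension {c ℓ} (K : Field c ℓ) {n k : ℕ} (blk : Fin n → Fin k) where
  open FieldFacts K
  open Blocks blk
  open Isomorphism K blk
  open PowerSetBasis K {n}

  Bs : List (BlockSubset blk)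
  Bs = blockSubsets blk

  orbits : Fin k → ℕ
  orbits i = suc (size i)

  Counts : Set
  Counts = (i : Fin k) → Fin (orbits i)

  counts : BlockSubset blk → Counts
  counts B i = fromℕ< (s≤s (countᶠ-≤ (B i)))

  toℕ-counts : ∀ B i → toℕ (counts B i) ≡ countᶠ (B i)
  toℕ-counts B i = toℕ-fromℕ< (s≤s (countᶠ-≤ (B i)))

  canonical : Counts → BlockSubset blk
  canonical c i = leading (toℕ (c i))

  counts-canonical : ∀ c i → counts (canonical c) i ≡ c i
  counts-canonical c i = toℕ-injective (≡.trans (toℕ-counts (canonical c) i) (countᶠ-leading (toℕ (c i)) (ℕP.≤-pred (toℕ<n (c i)))))

  counts-permute : ∀ B B' (ρ : BlockPerm) → (∀ i → Injective _≡_ _≡_ (ρ i)) → (∀ i j → B' i j ≡ B i (ρ i j)) → ∀ i → counts B i ≡ counts B' i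
  counts-permute B B' ρ ρ-inj h i = toℕ-injective (≡.trans (toℕ-counts B i)
    (≡.trans (≡.sym (countᶠ-permute (B i) (toPermutation (ρ i) (ρ-inj i)))) (≡.trans (countᶠ-cong _ _ (λ j → ≡.sym (h i j))) (≡.sym (toℕ-counts B' i)))))

  counts-cong : ∀ {B B'} → (∀ i j → B i j ≡ B' i j) → ∀ i → counts B i ≡ counts B' i
  counts-cong {B} {B'} B≗B' = counts-permute B B' (λ _ → id) (λ _ → id) (λ i j → ≡.sym (B≗B' i j))

  inOrbit : Counts → BlockSubset blk → Bool
  inOrbit κ B = eqΠ (counts B) κ

  inOrbit-cong : ∀ κ {B B'} → (∀ i → counts B i ≡ counts B' i) → inOrbit κ B ≡ inOrbit κ B'
  inOrbit-cong κ h = andF-cong _ _ (λ i → ≡.cong (_== κ i) (h i))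

  Λ : Counts → (Vec Bool n → Carrier) → Carrier
  Λ κ f = ∑ Bs (λ B → [ inOrbit κ B ] * f (toSubset blk B))

  Λ-pointwise : ∀ κ {f g} → (∀ A → f A ≈ g A) → Λ κ f ≈ Λ κ g
  Λ-pointwise κ f≈g = ∑-cong Bs (λ B → *-congˡ (f≈g (toSubset blk B)))

  Λ-⊖ : ∀ κ f g → Λ κ (λ A → f A ⊖ g A) ≈ Λ κ f ⊖ Λ κ g
  Λ-⊖ κ f g = trans (∑-cong Bs (λ B → *-distribˡ-⊖ _ _ _)) (trans (∑-∙ Bs _ _) (+-congˡ (sym (∑-distribˡ Bs (- 1#) _))))

  Λ-∑ : ∀ κ {a} {X : Set a} (xs : List X) (G : X → Vec Bool n → Carrier) → Λ κ (λ A → ∑ xs (λ x → G x A)) ≈ ∑ xs (λ x → Λ κ (G x))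
  Λ-∑ κ xs G = trans (∑-cong Bs (λ B → ∑-distribˡ xs _ _)) (∑-swap Bs xs _)

  Λ-act : ∀ κ j w → Λ κ (actP K (lookup (Young blk) j) w) ≈ Λ κ w
  Λ-act κ j w = ∑-permuteᴮ +-commutativeMonoid _ _
      (λ B≗B' → *-cong (≡⇒≈ (≡.cong [_] (inOrbit-cong κ (counts-cong B≗B')))) (≡⇒≈ (≡.cong w (toSubset-cong blk B≗B'))))
      (λ B → *-cong (≡⇒≈ (≡.cong [_] (inOrbit-cong κ (counts-permute B (permuteᴮ B) ρ ρ-injective (λ _ _ → refl)))))
                    (≡⇒≈ (≡.cong w (toSubset-permuteᴮ B))))
    where
    open YoungAction blk (lookup (Young blk) j) (All-lookup All-Young j)

  Λ-respects-≈P : ∀ κ {u v} → SetAlg._≈_ (⟨P⟩/Young K blk) u v → Λ κ u ≈ Λ κ v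
  Λ-respects-≈P κ {u} {v} u≈v with ≈P-elim u≈v
  ... | ps , h = ⊖≈0⇒≈ _ _ (begin
    Λ κ u ⊖ Λ κ v                               ≈⟨ Λ-⊖ κ u v ⟨
    Λ κ (λ A → u A ⊖ v A)                       ≈⟨ Λ-pointwise κ h ⟩
    Λ κ (λ A → ∑ ps (λ p → relator p A))         ≈⟨ Λ-∑ κ ps relator ⟩
    ∑ ps (λ p → Λ κ (relator p))                ≈⟨ ∑-cong ps (λ p → trans (Λ-⊖ κ (actP K (lookup (Young blk) (proj₁ p)) (proj₂ p)) (proj₂ p)) (trans (⊖-cong (Λ-act κ (proj₁ p) (proj₂ p)) ≈-refl) (x⊖x≈0 _))) ⟩
    ∑ ps (λ _ → 0#)                             ≈⟨ ∑-ε ps ⟩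
    0#                                          ∎)

  Λ-· : ∀ κ a f → Λ κ (λ A → a * f A) ≈ a * Λ κ f
  Λ-· κ a f = trans (∑-cong Bs (λ B → x∙yz≈y∙xz _ a _)) (sym (∑-distribˡ Bs a _))

  Λ-δ : ∀ κ B → Λ κ (δ (toSubset blk B)) ≈ [ inOrbit κ B ]
  Λ-δ κ B = trans (∑-cong Bs (λ B' → trans (*-comm _ _) (*-congʳ (≡⇒≈ (≡.cong [_] (≡.trans (eqᵇ-toSubset-toSubset blk B B') (eqᴮ-sym blk B B')))))))
    (∑-select Bs (λ B' → eqᴮ blk B' B) (λ B' → [ inOrbit κ B' ]) _ (count-blockSubsets blk B)
      (λ B' e → ≡⇒≈ (≡.cong [_] (inOrbit-cong κ (counts-cong (eqᴮ⇒≗ blk e))))))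

  dim : ℕ
  dim = prodF orbits

  basis : Fin dim → Vec Bool n → Carrier
  basis x = δ (toSubset blk (canonical (decode orbits x)))

  Λ-basis : ∀ κ x → Λ κ (basis x) ≈ [ eqΠ (decode orbits x) κ ]
  Λ-basis κ x = trans (Λ-δ κ (canonical (decode orbits x))) (≡⇒≈ (≡.cong [_] (andF-cong _ _ (λ i → ≡.cong (_== κ i) (counts-canonical (decode orbits x) i)))))

  lincomb-apply : (a : Fin dim → Carrier) → ∀ A → SetAlg.lincomb (⟨P⟩/Young K blk) dim a basis A ≡ ∑ (allFin dim) (λ x → a x * basis x A)
  lincomb-apply a = ΣV-apply (allFin dim) (λ x A → a x * basis x A)

  Λ-lincomb : ∀ κ (a : Fin dim → Carrier) → Λ κ (SetAlg.lincomb (⟨P⟩/Young K blk) dim a basis) ≈ ∑ (allFin dim) (λ x → a x * [ eqΠ (decode orbits x) κ ])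
  Λ-lincomb κ a = trans (Λ-pointwise κ (≡⇒≈ ∘ lincomb-apply a)) (trans (Λ-∑ κ (allFin dim) (λ x A → a x * basis x A))
    (∑-cong (allFin dim) (λ x → trans (Λ-· κ (a x) (basis x)) (*-congˡ (Λ-basis κ x)))))

  decode-injective : ∀ x y → eqΠ (decode orbits x) (decode orbits y) ≡ true → x ≡ y
  decode-injective x y e = ≡.trans (≡.sym (encode-decode orbits x)) (≡.trans (encode-cong orbits (eqΠ⇒≗ e)) (encode-decode orbits y))

  independent : ∀ (a : Fin dim → Carrier) → SetAlg._≈_ (⟨P⟩/Young K blk) (SetAlg.lincomb (⟨P⟩/Young K blk) dim a basis) (λ _ → 0#) → ∀ y → a y ≈ 0#
  independent a a·basis≈0 y = begin
    a y                                                                ≈⟨ ∑-select (allFin dim) (λ x → eqΠ (decode orbits x) (decode orbits y)) a (a y)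
                                                                            (count-decode orbits (decode orbits y)) (λ x e → ≡⇒≈ (≡.cong a (decode-injective x y e))) ⟨
    ∑ (allFin dim) (λ x → [ eqΠ (decode orbits x) (decode orbits y) ] * a x) ≈⟨ ∑-cong (allFin dim) (λ x → *-comm _ _) ⟩
    ∑ (allFin dim) (λ x → a x * [ eqΠ (decode orbits x) (decode orbits y) ]) ≈⟨ Λ-lincomb (decode orbits y) a ⟨
    Λ (decode orbits y) (SetAlg.lincomb (⟨P⟩/Young K blk) dim a basis)   ≈⟨ Λ-respects-≈P (decode orbits y) a·basis≈0 ⟩
    Λ (decode orbits y) (λ _ → 0#)                                       ≈⟨ trans (∑-cong Bs (λ B → zeroʳ _)) (∑-ε Bs) ⟩
    0#                                                                   ∎

  sorting-young : ∀ B → ∃ λ g → IsYoung g × (∀ i j → B i (restrictPerm g i j) ≡ canonical (counts B) i j)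
  sorting-young B = blockwise τ , blockwise-young τ (λ i → permutation-injective (π i)) , sorted
    where
    π : (i : Fin k) → Permutation (size i) (size i)
    π i = proj₁ (sort (B i))
    τ : BlockPerm
    τ i = π i ⟨$⟩ʳ_
    sorted : ∀ i j → B i (restrictPerm (blockwise τ) i j) ≡ canonical (counts B) i j
    sorted i j = ≡.trans (≡.cong (B i) (restrictPerm-blockwise τ i j))
      (≡.trans (proj₂ (sort (B i)) j) (≡.cong (λ r → leading r j) (≡.sym (toℕ-counts B i))))

  δ≈δ-canonical : ∀ B → SetAlg._≈_ (⟨P⟩/Young K blk) (δ (toSubset blk B)) (δ (toSubset blk (canonical (counts B))))
  δ≈δ-canonical B = ≈P-trans (≈P-pointwise same-orbit) (≈P-act j (δ (toSubset blk (canonical (counts B)))))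
    where
    g : Fin n → Fin n
    g = proj₁ (sorting-young B)
    young : IsYoung g
    young = proj₁ (proj₂ (sorting-young B))
    j : Fin (length (Young blk))
    j = proj₁ (lookup-Young g young)
    lookup≗g : ∀ x → lookup (Young blk) j x ≡ g x
    lookup≗g = proj₂ (lookup-Young g young)
    same-orbit : ∀ A → δ (toSubset blk B) A ≈ actP K (lookup (Young blk) j) (δ (toSubset blk (canonical (counts B)))) A
    same-orbit A = begin
      δ (toSubset blk B) A                                          ≡⟨ δ-permute g (proj₁ young) (toSubset blk B) A ⟨
      δ (permuteVec (toSubset blk B) g) (permuteVec A g)
        ≡⟨ ≡.cong₂ δ (≡.trans (YoungAction.toSubset-permuteᴮ blk g young B) (toSubset-cong blk (proj₂ (proj₂ (sorting-young B)))))
                     (VecP.tabulate-cong (λ x → ≡.cong (Vec.lookup A) (≡.sym (lookup≗g x)))) ⟩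
      δ (toSubset blk (canonical (counts B))) (permuteVec A (lookup (Young blk) j)) ∎

  δ-expansion : ∀ v A → ∑ Bs (λ B → v (toSubset blk B) * δ (toSubset blk B) A) ≈ v A
  δ-expansion v A = trans (∑-cong Bs (λ B → trans (*-comm _ _) (*-congʳ (≡⇒≈ (≡.cong [_] (eqᵇ-toSubset blk B A))))))
    (∑-select Bs (λ B → eqᴮ blk B (fromSubset blk A)) (v ∘ toSubset blk) (v A) (count-blockSubsets blk (fromSubset blk A))
      (λ B e → ≡⇒≈ (≡.cong v (≡.trans (toSubset-cong blk (eqᴮ⇒≗ blk e)) (toSubset-fromSubset blk A)))))

  collect-orbits : ∀ v A → ∑ Bs (λ B → v (toSubset blk B) * δ (toSubset blk (canonical (counts B))) A)
                         ≈ SetAlg.lincomb (⟨P⟩/Young K blk) dim (λ x → Λ (decode orbits x) v) basis A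
  collect-orbits v A = sym (begin
    SetAlg.lincomb (⟨P⟩/Young K blk) dim (λ x → Λ (decode orbits x) v) basis A
      ≡⟨ lincomb-apply (λ x → Λ (decode orbits x) v) A ⟩
    ∑ (allFin dim) (λ x → Λ (decode orbits x) v * basis x A)
      ≈⟨ ∑-cong (allFin dim) (λ x → ∑-distribʳ Bs (basis x A) _) ⟩
    ∑ (allFin dim) (λ x → ∑ Bs (λ B → ([ inOrbit (decode orbits x) B ] * v (toSubset blk B)) * basis x A))
      ≈⟨ ∑-swap (allFin dim) Bs _ ⟩
    ∑ Bs (λ B → ∑ (allFin dim) (λ x → ([ inOrbit (decode orbits x) B ] * v (toSubset blk B)) * basis x A))
      ≈⟨ ∑-cong Bs (λ B → trans (∑-cong (allFin dim) (λ x → trans (*-congʳ (*-comm _ _)) (*-assoc _ _ _))) (sym (∑-distribˡ (allFin dim) _ _))) ⟩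
    ∑ Bs (λ B → v (toSubset blk B) * ∑ (allFin dim) (λ x → [ inOrbit (decode orbits x) B ] * basis x A))
      ≈⟨ ∑-cong Bs (λ B → *-congˡ (∑-select (allFin dim) (λ x → inOrbit (decode orbits x) B) (λ x → basis x A) _
           (≡.trans (count-cong _ _ (allFin dim) (All.universal (λ x → eqΠ-sym (counts B) (decode orbits x)) _)) (count-decode orbits (counts B)))
           (λ x e → ≡⇒≈ (≡.cong (λ X → δ X A) (toSubset-cong blk (λ i j → ≡.cong (λ c → leading (toℕ c) j) (≡.sym (eqΠ⇒≗ e i)))))))) ⟩
    ∑ Bs (λ B → v (toSubset blk B) * δ (toSubset blk (canonical (counts B))) A) ∎)

  spanning : ∀ v → SetAlg._≈_ (⟨P⟩/Young K blk) v (SetAlg.lincomb (⟨P⟩/Young K blk) dim (λ x → Λ (decode orbits x) v) basis)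
  spanning v = ≈P-trans (≈P-pointwise (λ A → sym (δ-expansion v A)))
    (≈P-trans (≈P-∑ Bs (v ∘ toSubset blk) δ≈δ-canonical) (≈P-pointwise (collect-orbits v)))

  hasDim : HasDim (⟨P⟩/Young K blk) (dimFormula blk)
  hasDim = ≡.subst (HasDim (⟨P⟩/Young K blk)) (≡.sym (product-allFin orbits))
    (basis , independent , λ v → (λ x → Λ (decode orbits x) v) , spanning v)

proposition3p5 : ∀ {c ℓ : Level} (K : Field c ℓ) → CharZero K →
    (n k : ℕ) (blk : Fin n → Fin k) → (∀ i → ∃ λ j → blk j ≡ i) →
    AlgIso (⟨P⟩/Young K blk) (⊗Sym K blk) × HasDim (⟨P⟩/Young K blk) (dimFormula blk)
proposition3p5 K char-0 n k blk _ = Operations.isomorphism K char-0 blk , Dimension.hasDim K blk
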